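{- An $r$-graph $F$ has a strict stable labeling if and only if $|E(F)|=\Delta(F)\,\nu^*(F)$.
   Context: $\nu^*(F)$ is the maximum of $\sum_{e\in E(F)}w_e$ over $w:E(F)\to[0,\infty)$ with $\sum_{e\ni v}w_e\le1$ for all vertices $v$. A labeling of $F$ is $\lambda:V(F)\to[0,1]$ with $\sum_{v\in e}\lambda_v\in\{0,1\}$ for every edge and $\lambda_v=0$ whenever $\deg_F(v)<\Delta(F)$; it is strict if $\sum_{v\in e}\lambda_v=1$ for every edge; it is stable if there is no other labeling $\lambda'\ne\lambda$ with (a) the same edge sums, (b) the same zero set $\{v:\lambda_v=0\}$, and (c) $\lambda_u=\lambda_v\iff\lambda'_u=\lambda'_v$ for all $u,v$.
   Formalization: The weights w in the definition of ν*(F), the labelings λ, and the competing labelings λ′ in the stability condition take rational values. -}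

module Defs where

open import Data.Nat as ℕ using (ℕ; _⊔_)
open import Data.Integer using (+_)
open import Data.Rational using (ℚ; 0ℚ; 1ℚ; _+_; _*_; _≤_; _/_)
open import Data.Fin using (Fin)
open import Data.Fin.Subset using (Subset; _∈_; ∣_∣)
open import Data.Fin.Subset.Properties using (_∈?_)
open import Data.List using (List; length; foldr; map; filter; lookup; allFin)
open import Data.List.Relation.Unary.All using (All)
open import Data.List.Relation.Unary.Unique.Propositional using (Unique)
open import Data.Product using (Σ; _×_)
open import Data.Sum using (_⊎_)
open import Relation.Nullary using (¬_; yes; no)
open import Relation.Binary.PropositionalEquality using (_≡_)
open import Function.Bundles using (_⇔_)

record RGraph (r n : ℕ) : Set where
  field
    edges   : List (Subset n)
    uniform : All (λ e → ∣ e ∣ ≡ r) edges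
    simple  : Unique edges
open RGraph public

toℚ : ℕ → ℚ
toℚ k = + k / 1

sumℚ : List ℚ → ℚ
sumℚ = foldr _+_ 0ℚ

numEdges : ∀ {r n} → RGraph r n → ℕ
numEdges F = length (edges F)

Edge : ∀ {r n} → RGraph r n → Set
Edge F = Fin (length (edges F))

edge : ∀ {r n} (F : RGraph r n) → Edge F → Subset n
edge F i = lookup (edges F) i

deg : ∀ {r n} → RGraph r n → Fin n → ℕ
deg F v = length (filter (v ∈?_) (edges F))

Δ : ∀ {r n} → RGraph r n → ℕ
Δ {n = n} F = foldr _⊔_ 0 (map (deg F) (allFin n))

vertexLoad : ∀ {r n} (F : RGraph r n) → (Edge F → ℚ) → Fin n → ℚ
vertexLoad F w v = sumℚ (map w (filter (λ i → v ∈? edge F i) (allFin _)))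

IsFracMatching : ∀ {r n} (F : RGraph r n) → (Edge F → ℚ) → Set
IsFracMatching F w = (∀ i → 0ℚ ≤ w i) × (∀ v → vertexLoad F w v ≤ 1ℚ)

weight : ∀ {r n} (F : RGraph r n) → (Edge F → ℚ) → ℚ
weight F w = sumℚ (map w (allFin _))

IsNuStar : ∀ {r n} → RGraph r n → ℚ → Set
IsNuStar F ν =
  (Σ (Edge F → ℚ) λ w → IsFracMatching F w × (weight F w ≡ ν))
  × (∀ w → IsFracMatching F w → weight F w ≤ ν)

edgeSum : ∀ {n} → (Fin n → ℚ) → Subset n → ℚ
edgeSum {n} lab e = sumℚ (map lab (filter (_∈? e) (allFin n)))

IsLabeling : ∀ {r n} → RGraph r n → (Fin n → ℚ) → Set
IsLabeling {n = n} F lab =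
  (∀ v → 0ℚ ≤ lab v × lab v ≤ 1ℚ)
  × (∀ i → edgeSum lab (edge F i) ≡ 0ℚ ⊎ edgeSum lab (edge F i) ≡ 1ℚ)
  × (∀ v → deg F v ℕ.< Δ F → lab v ≡ 0ℚ)

IsStrict : ∀ {r n} → RGraph r n → (Fin n → ℚ) → Set
IsStrict F lab = ∀ i → edgeSum lab (edge F i) ≡ 1ℚ

IsStable : ∀ {r n} → RGraph r n → (Fin n → ℚ) → Set
IsStable {n = n} F lab =
  ¬ (Σ (Fin n → ℚ) λ lab' →
       IsLabeling F lab'
     × ¬ (∀ v → lab' v ≡ lab v)
     × (∀ i → edgeSum lab' (edge F i) ≡ edgeSum lab (edge F i))
     × (∀ v → (lab v ≡ 0ℚ) ⇔ (lab' v ≡ 0ℚ))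
     × (∀ u v → (lab u ≡ lab v) ⇔ (lab' u ≡ lab' v)))

HasStrictStableLabeling : ∀ {r n} → RGraph r n → Set
HasStrictStableLabeling {n = n} F =
  Σ (Fin n → ℚ) λ lab → IsLabeling F lab × IsStrict F lab × IsStable F lab

{-# OPTIONS --safe #-}
module Submission where

-- A strict labeling λ certifies |E| = Δ·ν*. Adding up its edge sums counts each λ_v exactly
-- deg(v) times, and λ vanishes below maximum degree, so |E| = Δ·Σλ; λ is a fractional vertex
-- cover, so no fractional matching weighs more than Σλ; and the constant matching 1/Δ weighs
-- |E|/Δ = Σλ. Conversely, suppose |E| = Δ·ν*. By Farkas' lemma, which Fourier–Motzkin
-- elimination proves constructively over ℚ, the linear system defining strict labelings is
-- either solvable or has a dual ray y with Σy < 0 whose load is nonnegative at every vertex of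
-- maximum degree; moving the matching 1/Δ along -y would beat ν*, so a strict labeling exists.
-- A strict labeling of minimal support is stable: a rival labeling with the same edge sums and
-- zero set gives a direction d, vanishing off the support and on every edge sum, and walking
-- from λ along -d until a coordinate hits 0 (the ratio test) gives a strict labeling of smaller
-- support.

open import Defs

open import Algebra.Bundles using (CommutativeRing)
open import Data.Bool.Base using (Bool; true; false; if_then_else_)
open import Data.Empty using (⊥; ⊥-elim)
open import Data.Fin.Base using (Fin; zero; suc)
open import Data.Fin.Properties using (any?; ¬∀⟶∃¬) renaming (_≟_ to _≟ᶠ_)
open import Data.Fin.Subset using (Subset; inside; outside; _⊂_)
  renaming (_∈_ to _∈ₛ_; _∉_ to _∉ₛ_; _⊆_ to _⊆ₛ_)
open import Data.Fin.Subset.Induction using (Acc; acc; ⊂-wellFounded)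
open import Data.Fin.Subset.Properties using (_∈?_)
import Data.Integer.Base as ℤ
import Data.Integer.Properties as ℤ
open import Data.List.Base
  using (List; []; _∷_; _++_; length; map; filter; foldr; tabulate; allFin; cartesianProductWith)
import Data.List.Extrema
open import Data.List.Membership.Propositional using (_∈_)
open import Data.List.Membership.Propositional.Properties using (∈-cartesianProductWith⁺; ∈-filter⁺; ∈-allFin)
open import Data.List.Properties using (tabulate-lookup; map-tabulate)
open import Data.List.Relation.Binary.Subset.Propositional using (_⊆_)
open import Data.List.Relation.Unary.All as All using (All; []; _∷_)
open import Data.List.Relation.Unary.All.Properties as All
  using (++⁺; ++⁻ˡ; ++⁻ʳ; cartesianProductWith⁺; all-filter)
open import Data.List.Relation.Unary.Any using (here; there)
open import Data.Nat.Base as ℕ using (ℕ; zero; suc; z≤n; s≤s)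
open import Data.Nat.Coprimality using (1-coprimeTo) renaming (sym to coprime-sym)
import Data.Nat.Properties as ℕ
open import Data.Product.Base using (Σ; ∃; _×_; _,_; proj₁; proj₂)
open import Data.Rational.Base
  using (ℚ; 0ℚ; 1ℚ; _+_; _*_; _-_; -_; _≤_; _<_; ∣_∣; 1/_; _/_; mkℚ; ≢-nonZero; positive; nonNegative)
open import Data.Rational.Properties
open import Data.Rational.Solver using (module +-*-Solver)
open import Data.Sum.Base as Sum using (_⊎_; inj₁; inj₂; [_,_]′)
import Data.Vec.Base as Vec
open import Data.Vec.Functional using () renaming (_∷_ to _∷ᵥ_)
open import Data.Vec.Properties using (lookup⇒[]=; []=⇒lookup; lookup∘tabulate)
open import Function.Base using (_∘_; id)
open import Function.Bundles using (_⇔_; mk⇔; Equivalence)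
open import Relation.Binary.Bundles using (DecTotalOrder)
open import Relation.Binary.Definitions using (tri<; tri≈; tri>)
open import Relation.Binary.PropositionalEquality
  using (_≡_; _≢_; _≗_; refl; sym; trans; cong; cong₂; subst; subst₂; setoid; ≢-sym; module ≡-Reasoning)
open import Relation.Nullary using (¬_; Dec; yes; no; does; contradiction)
open import Relation.Nullary.Decidable using (dec-true; dec-false)
open import Relation.Unary using (Decidable)

open import Algebra.Properties.Semiring.Sum (CommutativeRing.semiring +-*-commutativeRing)
  using (sum; sum-syntax; sum-cong-≗; sum-replicate-zero; ∑-distrib-+; ∑-comm; *-distribˡ-sum; *-distribʳ-sum)
open Data.List.Extrema (DecTotalOrder.totalOrder ≤-decTotalOrder)
  using (min; max; argmin; min≤xs; max≤v⁺; xs≤max; argmin-all; f[argmin]≤f[xs])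
open +-*-Solver using (solve; _:+_; _:*_; _:-_; :-_; _:=_; con)

pos⇒≢0 : ∀ {p} → 0ℚ < p → p ≢ 0ℚ
pos⇒≢0 p>0 = ≢-sym (<⇒≢ p>0)

0<1 : 0ℚ < 1ℚ
0<1 = positive⁻¹ 1ℚ

recip : (p : ℚ) → p ≢ 0ℚ → ℚ
recip p p≢0 = (1/ p) {{≢-nonZero p≢0}}

recip-inverseˡ : ∀ p (p≢0 : p ≢ 0ℚ) → recip p p≢0 * p ≡ 1ℚ
recip-inverseˡ p p≢0 = *-inverseˡ p {{≢-nonZero p≢0}}

recip-pos : ∀ {p} (p≢0 : p ≢ 0ℚ) → 0ℚ < p → 0ℚ < recip p p≢0
recip-pos {p} p≢0 p>0 = positive⁻¹ _ {{1/pos⇒pos p {{positive p>0}}}}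

*-nonNeg : ∀ {p q} → 0ℚ ≤ p → 0ℚ ≤ q → 0ℚ ≤ p * q
*-nonNeg {p} {q} p≥0 q≥0 =
  nonNegative⁻¹ _ {{nonNeg*nonNeg⇒nonNeg p {{nonNegative p≥0}} q {{nonNegative q≥0}}}}

*-pos : ∀ {p q} → 0ℚ < p → 0ℚ < q → 0ℚ < p * q
*-pos {p} {q} p>0 q>0 = positive⁻¹ _ {{pos*pos⇒pos p {{positive p>0}} q {{positive q>0}}}}

neg-involutive : ∀ p → - (- p) ≡ p
neg-involutive = solve 1 (λ p → :- (:- p) := p) refl

neg-cancel-≤ : ∀ {p q} → - p ≤ - q → q ≤ p
neg-cancel-≤ {p} {q} -p≤-q = subst₂ _≤_ (neg-involutive q) (neg-involutive p) (neg-antimono-≤ -p≤-q)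

p≤q⇒0≤q-p : ∀ {p q} → p ≤ q → 0ℚ ≤ q - p
p≤q⇒0≤q-p {p} {q} p≤q = subst (_≤ q - p) (+-inverseʳ p) (+-monoˡ-≤ (- p) p≤q)

p-q≡0⇒p≡q : ∀ {p q} → p - q ≡ 0ℚ → p ≡ q
p-q≡0⇒p≡q {p} {q} p-q≡0 = begin
  p             ≡⟨ solve 2 (λ p q → p := (p :- q) :+ q) refl p q ⟩
  (p - q) + q   ≡⟨ cong (_+ q) p-q≡0 ⟩
  0ℚ + q        ≡⟨ +-identityˡ q ⟩
  q             ∎
  where open ≡-Reasoning

p≤∣p∣ : ∀ p → p ≤ ∣ p ∣
p≤∣p∣ p with ∣p∣≡p∨∣p∣≡-p p
... | inj₁ ∣p∣≡p  = ≤-reflexive (sym ∣p∣≡p)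
... | inj₂ ∣p∣≡-p = ≤-trans (neg-cancel-≤ (subst (0ℚ ≤_) ∣p∣≡-p (0≤∣p∣ p))) (0≤∣p∣ p)

-p≤∣p∣ : ∀ p → - p ≤ ∣ p ∣
-p≤∣p∣ p = subst (- p ≤_) (∣-p∣≡∣p∣ p) (p≤∣p∣ (- p))

infixl 7 _/?_

-- p / q, with the junk value 0 when q = 0.
_/?_ : ℚ → ℚ → ℚ
p /? q with q ≟ 0ℚ
... | yes _   = 0ℚ
... | no q≢0 = p * recip q q≢0

/?-cancel : ∀ p {q} → q ≢ 0ℚ → p /? q * q ≡ p
/?-cancel p {q} q≢0 with q ≟ 0ℚ
... | yes q≡0 = contradiction q≡0 q≢0
... | no q≢0′ = trans (*-assoc p _ q) (trans (cong (p *_) (recip-inverseˡ q q≢0′)) (*-identityʳ p))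

/?-nonNeg : ∀ {p q} → 0ℚ ≤ p → 0ℚ < q → 0ℚ ≤ p /? q
/?-nonNeg {p} {q} p≥0 q>0 with q ≟ 0ℚ
... | yes _   = ≤-refl
... | no q≢0 = *-nonNeg p≥0 (<⇒≤ (recip-pos q≢0 q>0))

𝟙 : Bool → ℚ
𝟙 true  = 1ℚ
𝟙 false = 0ℚ

𝟙-nonNeg : ∀ b → 0ℚ ≤ 𝟙 b
𝟙-nonNeg true  = <⇒≤ 0<1
𝟙-nonNeg false = ≤-refl

𝟙≢0⇒≡1 : ∀ b → 𝟙 b ≢ 0ℚ → 𝟙 b ≡ 1ℚ
𝟙≢0⇒≡1 true  _   = refl
𝟙≢0⇒≡1 false 0≢0 = contradiction refl 0≢0

-[𝟙*p]≤∣p∣ : ∀ b p → - (𝟙 b * p) ≤ ∣ p ∣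
-[𝟙*p]≤∣p∣ true  p = subst (_≤ ∣ p ∣) (cong -_ (sym (*-identityˡ p))) (-p≤∣p∣ p)
-[𝟙*p]≤∣p∣ false p = subst (_≤ ∣ p ∣) (cong -_ (sym (*-zeroˡ p))) (0≤∣p∣ p)

toℚ-suc : ∀ k → toℚ (suc k) ≡ 1ℚ + toℚ k
toℚ-suc k = sym (trans (cong₂ _+_ (toℚ-mkℚ 1) (toℚ-mkℚ k))
  (cong (_/ 1) (cong₂ ℤ._+_ (ℤ.*-identityʳ (ℤ.+ 1)) (ℤ.*-identityʳ (ℤ.+ k)))))
  where
  toℚ-mkℚ : ∀ k → toℚ k ≡ mkℚ (ℤ.+ k) 0 (coprime-sym (1-coprimeTo k))
  toℚ-mkℚ k = normalize-coprime (coprime-sym (1-coprimeTo k))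

toℚ-nonNeg : ∀ k → 0ℚ ≤ toℚ k
toℚ-nonNeg k = nonNegative⁻¹ _ {{normalize-nonNeg k 1}}

toℚ-pos : ∀ k → 0ℚ < toℚ (suc k)
toℚ-pos k = positive⁻¹ _ {{normalize-pos (suc k) 1}}

toℚ-mono-≤ : ∀ {j k} → j ℕ.≤ k → toℚ j ≤ toℚ k
toℚ-mono-≤ {k = k} z≤n = toℚ-nonNeg k
toℚ-mono-≤ {suc j} {suc k} (s≤s j≤k) =
  subst₂ _≤_ (sym (toℚ-suc j)) (sym (toℚ-suc k)) (+-monoʳ-≤ 1ℚ (toℚ-mono-≤ j≤k))

toℚ-zero-or-pos : ∀ k → k ≡ 0 ⊎ 0ℚ < toℚ k
toℚ-zero-or-pos zero    = inj₁ refl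
toℚ-zero-or-pos (suc k) = inj₂ (toℚ-pos k)

toℚ≡0⇒≡0 : ∀ {k} → toℚ k ≡ 0ℚ → k ≡ 0
toℚ≡0⇒≡0 {zero} _ = refl
toℚ≡0⇒≡0 {suc k} eq = contradiction eq (pos⇒≢0 (toℚ-pos k))

∑-zero : ∀ {n} → ∑[ i < n ] 0ℚ ≡ 0ℚ
∑-zero {n} = sum-replicate-zero n

∑-neg : ∀ {n} (f : Fin n → ℚ) → ∑[ i < n ] (- f i) ≡ - sum f
∑-neg {zero} f = refl
∑-neg {suc n} f =
  trans (cong ((- f zero) +_) (∑-neg (f ∘ suc))) (sym (neg-distrib-+ (f zero) (sum (f ∘ suc))))

∑-sub : ∀ {n} (f g : Fin n → ℚ) → ∑[ i < n ] (f i - g i) ≡ sum f - sum g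
∑-sub f g = trans (∑-distrib-+ f (λ i → - g i)) (cong (sum f +_) (∑-neg g))

∑-const : ∀ {n} c → ∑[ i < n ] c ≡ toℚ n * c
∑-const {zero} c = sym (*-zeroˡ c)
∑-const {suc n} c = begin
  c + ∑[ i < n ] c    ≡⟨ cong (c +_) (∑-const {n} c) ⟩
  c + toℚ n * c       ≡⟨ solve 2 (λ c k → c :+ k :* c := (con 1ℚ :+ k) :* c) refl c (toℚ n) ⟩
  (1ℚ + toℚ n) * c    ≡⟨ cong (_* c) (sym (toℚ-suc n)) ⟩
  toℚ (suc n) * c     ∎
  where open ≡-Reasoning

∑-mono-≤ : ∀ {n} {f g : Fin n → ℚ} → (∀ i → f i ≤ g i) → sum f ≤ sum g
∑-mono-≤ {zero} f≤g = ≤-refl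
∑-mono-≤ {suc n} f≤g = +-mono-≤ (f≤g zero) (∑-mono-≤ (f≤g ∘ suc))

∑-nonNeg : ∀ {n} {f : Fin n → ℚ} → (∀ i → 0ℚ ≤ f i) → 0ℚ ≤ sum f
∑-nonNeg {n} {f} f≥0 = subst (_≤ sum f) (∑-zero {n}) (∑-mono-≤ {f = λ _ → 0ℚ} f≥0)

term≤∑ : ∀ {n} {f : Fin n → ℚ} → (∀ i → 0ℚ ≤ f i) → ∀ i → f i ≤ sum f
term≤∑ {f = f} f≥0 zero =
  subst (_≤ sum f) (+-identityʳ (f zero)) (+-monoʳ-≤ (f zero) (∑-nonNeg (f≥0 ∘ suc)))
term≤∑ {f = f} f≥0 (suc i) = ≤-trans (term≤∑ (f≥0 ∘ suc) i)
  (subst (_≤ sum f) (+-identityˡ (sum (f ∘ suc))) (+-monoˡ-≤ (sum (f ∘ suc)) (f≥0 zero)))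

∑≢0⇒∃≢0 : ∀ {n} (f : Fin n → ℚ) → sum f ≢ 0ℚ → ∃ λ i → f i ≢ 0ℚ
∑≢0⇒∃≢0 {zero} f ∑≢0 = contradiction refl ∑≢0
∑≢0⇒∃≢0 {suc n} f ∑≢0 with f zero ≟ 0ℚ
... | no f₀≢0 = zero , f₀≢0
... | yes f₀≡0
  with ∑≢0⇒∃≢0 (f ∘ suc) (λ ∑≡0 → ∑≢0 (trans (cong₂ _+_ f₀≡0 ∑≡0) (+-identityˡ 0ℚ)))
...   | i , fᵢ≢0 = suc i , fᵢ≢0

δ : ∀ {n} → Fin n → Fin n → ℚ
δ v u = 𝟙 (does (v ≟ᶠ u))

∑-δ : ∀ {n} (v : Fin n) (f : Fin n → ℚ) → ∑[ u < n ] (δ v u * f u) ≡ f v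
∑-δ {suc n} zero f = begin
  1ℚ * f zero + ∑[ u < n ] (0ℚ * f (suc u))  ≡⟨ cong₂ _+_ (*-identityˡ (f zero)) rest≡0 ⟩
  f zero + 0ℚ                               ≡⟨ +-identityʳ (f zero) ⟩
  f zero                                    ∎
  where
  open ≡-Reasoning
  rest≡0 : ∑[ u < n ] (0ℚ * f (suc u)) ≡ 0ℚ
  rest≡0 = trans (sum-cong-≗ (λ u → *-zeroˡ (f (suc u)))) (∑-zero {n})
∑-δ (suc v) f = trans (cong (_+ ∑[ u < _ ] (δ v u * f (suc u))) (*-zeroˡ (f zero)))
                      (trans (+-identityˡ _) (∑-δ v (f ∘ suc)))

∑-δ-const : ∀ {n} (v : Fin n) → ∑[ u < n ] δ v u ≡ 1ℚ
∑-δ-const v = trans (sum-cong-≗ (λ u → sym (*-identityʳ (δ v u)))) (∑-δ v (λ _ → 1ℚ))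

-- Systems of linear inequalities

-- The row a ∣ b stands for the inequality a · x ≤ b, or in a system of equations for a · x = b.
record Row (n : ℕ) : Set where
  constructor _∣_
  field
    coeffs : Fin n → ℚ
    rhs    : ℚ
open Row

infix 8 _·_

_·_ : ∀ {n} → (Fin n → ℚ) → (Fin n → ℚ) → ℚ
a · x = sum (λ j → a j * x j)

·-distribʳ-+ : ∀ {n} (a a′ x : Fin n → ℚ) → (λ j → a j + a′ j) · x ≡ a · x + a′ · x
·-distribʳ-+ a a′ x =
  trans (sum-cong-≗ (λ j → *-distribʳ-+ (x j) (a j) (a′ j))) (∑-distrib-+ (λ j → a j * x j) (λ j → a′ j * x j))

·-scaleˡ : ∀ {n} c (a x : Fin n → ℚ) → (λ j → c * a j) · x ≡ c * (a · x)
·-scaleˡ c a x = trans (sum-cong-≗ (λ j → *-assoc c (a j) (x j))) (sym (*-distribˡ-sum c (λ j → a j * x j)))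

·-negˡ : ∀ {n} (a x : Fin n → ℚ) → (λ j → - a j) · x ≡ - (a · x)
·-negˡ a x = trans (sum-cong-≗ (λ j → sym (neg-distribˡ-* (a j) (x j)))) (∑-neg (λ j → a j * x j))

·-congˡ : ∀ {n} {a a′ : Fin n → ℚ} (x : Fin n → ℚ) → a ≗ a′ → a · x ≡ a′ · x
·-congˡ x a≗a′ = sum-cong-≗ (λ j → cong (_* x j) (a≗a′ j))

0· : ∀ {n} (x : Fin n → ℚ) → (λ _ → 0ℚ) · x ≡ 0ℚ
0· {n} x = trans (sum-cong-≗ (λ j → *-zeroˡ (x j))) (∑-zero {n})

·-sub-scaledʳ : ∀ {n} (a x y : Fin n → ℚ) t → a · (λ u → x u - t * y u) ≡ a · x - t * (a · y)
·-sub-scaledʳ {n} a x y t = begin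
  a · (λ u → x u - t * y u)                 ≡⟨ sum-cong-≗ expand ⟩
  ∑[ u < n ] (a u * x u - t * (a u * y u))  ≡⟨ ∑-sub (λ u → a u * x u) (λ u → t * (a u * y u)) ⟩
  a · x - ∑[ u < n ] (t * (a u * y u))      ≡⟨ cong (_-_ (a · x)) (sym (*-distribˡ-sum t (λ u → a u * y u))) ⟩
  a · x - t * (a · y)                       ∎
  where
  open ≡-Reasoning
  expand : ∀ u → a u * (x u - t * y u) ≡ a u * x u - t * (a u * y u)
  expand u = solve 4 (λ a x t y → a :* (x :- t :* y) := a :* x :- t :* (a :* y)) refl (a u) (x u) t (y u)

·-scaled-subʳ : ∀ {n} (a x y : Fin n → ℚ) c → a · (λ u → c * (x u - y u)) ≡ c * (a · x - a · y)
·-scaled-subʳ {n} a x y c = begin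
  a · (λ u → c * (x u - y u))               ≡⟨ sum-cong-≗ expand ⟩
  ∑[ u < n ] (c * (a u * x u - a u * y u))  ≡⟨ sym (*-distribˡ-sum c (λ u → a u * x u - a u * y u)) ⟩
  c * ∑[ u < n ] (a u * x u - a u * y u)    ≡⟨ cong (c *_) (∑-sub (λ u → a u * x u) (λ u → a u * y u)) ⟩
  c * (a · x - a · y)                       ∎
  where
  open ≡-Reasoning
  expand : ∀ u → a u * (c * (x u - y u)) ≡ c * (a u * x u - a u * y u)
  expand u = solve 4 (λ a c x y → a :* (c :* (x :- y)) := c :* (a :* x :- a :* y)) refl (a u) c (x u) (y u)

infix 4 _⊨_ _⊢_

_⊨_ : ∀ {n} → (Fin n → ℚ) → Row n → Set
x ⊨ r = coeffs r · x ≤ rhs r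

Solution : ∀ {n} → List (Row n) → Set
Solution {n} S = Σ (Fin n → ℚ) λ x → All (x ⊨_) S

data _⊢_ {n} (S : List (Row n)) : Row n → Set where
  hyp   : ∀ {r} → r ∈ S → S ⊢ r
  add   : ∀ {a b a′ b′} → S ⊢ (a ∣ b) → S ⊢ (a′ ∣ b′) → S ⊢ ((λ j → a j + a′ j) ∣ (b + b′))
  scale : ∀ {a b} c → 0ℚ ≤ c → S ⊢ (a ∣ b) → S ⊢ ((λ j → c * a j) ∣ (c * b))
  resp  : ∀ {a b a′ b′} → a ≗ a′ → b ≡ b′ → S ⊢ (a ∣ b) → S ⊢ (a′ ∣ b′)

Refutation : ∀ {n} → List (Row n) → Set
Refutation S = Σ ℚ λ b → b < 0ℚ × S ⊢ ((λ _ → 0ℚ) ∣ b)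

record ConeClosed {n} (P : Row n → Set) : Set where
  field
    add-closed   : ∀ {a b a′ b′} → P (a ∣ b) → P (a′ ∣ b′) → P ((λ j → a j + a′ j) ∣ (b + b′))
    scale-closed : ∀ {a b} c → 0ℚ ≤ c → P (a ∣ b) → P ((λ j → c * a j) ∣ (c * b))
    resp-closed  : ∀ {a b a′ b′} → a ≗ a′ → b ≡ b′ → P (a ∣ b) → P (a′ ∣ b′)

⊢-induction : ∀ {n} {P : Row n → Set} {S} → ConeClosed P → All P S → ∀ {r} → S ⊢ r → P r
⊢-induction {P = P} {S} P-closed PS = go
  where
  open ConeClosed P-closed
  go : ∀ {r} → S ⊢ r → P r
  go (hyp r∈S)          = All.lookup PS r∈S
  go (add d d′)         = add-closed (go d) (go d′)
  go (scale c c≥0 d)    = scale-closed c c≥0 (go d)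
  go (resp a≗a′ b≡b′ d) = resp-closed a≗a′ b≡b′ (go d)

⊨-coneClosed : ∀ {n} (x : Fin n → ℚ) → ConeClosed (x ⊨_)
⊨-coneClosed x = record
  { add-closed   = λ {a} {b} {a′} {b′} ax≤b a′x≤b′ →
      subst (_≤ b + b′) (sym (·-distribʳ-+ a a′ x)) (+-mono-≤ ax≤b a′x≤b′)
  ; scale-closed = λ {a} {b} c c≥0 ax≤b →
      subst (_≤ c * b) (sym (·-scaleˡ c a x)) (*-monoˡ-≤-nonNeg c {{nonNegative c≥0}} ax≤b)
  ; resp-closed  = λ a≗a′ b≡b′ ax≤b → subst₂ _≤_ (·-congˡ x a≗a′) b≡b′ ax≤b
  }

⊢-sound : ∀ {n} {S : List (Row n)} {r x} → S ⊢ r → All (x ⊨_) S → x ⊨ r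
⊢-sound {x = x} d xS = ⊢-induction (⊨-coneClosed x) xS d

refutation⇒¬solution : ∀ {n} {S : List (Row n)} → Refutation S → ¬ Solution S
refutation⇒¬solution (b , b<0 , d) (x , xS) =
  <-irrefl refl (≤-<-trans (subst (_≤ b) (0· x) (⊢-sound d xS)) b<0)

⊢-coneClosed : ∀ {n} (T : List (Row n)) → ConeClosed (T ⊢_)
⊢-coneClosed T = record { add-closed = add ; scale-closed = scale ; resp-closed = resp }

⊢-mono : ∀ {n} {S T : List (Row n)} → S ⊆ T → ∀ {r} → S ⊢ r → T ⊢ r
⊢-mono S⊆T = ⊢-induction (⊢-coneClosed _) (All.tabulate (hyp ∘ S⊆T))

-- Fourier–Motzkin elimination

_◃_ : ∀ {n} → ℚ → Row n → Row (suc n)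
h ◃ r = (h ∷ᵥ coeffs r) ∣ rhs r

data Pivot : Set where
  none up down : Pivot

pivotCoeff : Pivot → ℚ
pivotCoeff none = 0ℚ
pivotCoeff up   = 1ℚ
pivotCoeff down = - 1ℚ

record Normalised {n} (r : Row (suc n)) : Set where
  constructor normalised
  field
    pivot  : Pivot
    rest   : Row n
    derive : ∀ {S} → S ⊢ r → S ⊢ pivotCoeff pivot ◃ rest
    back   : ∀ x → x ⊨ pivotCoeff pivot ◃ rest → x ⊨ r

scaleToPivot : ∀ {n} (r : Row (suc n)) c → 0ℚ < c → ∀ p → c * coeffs r zero ≡ pivotCoeff p → Normalised r
scaleToPivot r c c>0 p c·r₀≡p = normalised p ((λ j → c * coeffs r (suc j)) ∣ (c * rhs r))
  (λ d → resp c·r≗ refl (scale c (<⇒≤ c>0) d))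
  (λ x x⊨ → *-cancelˡ-≤-pos c {{positive c>0}} (subst (_≤ c * rhs r) (c·r·x x) x⊨))
  where
  c·r≗ : (λ j → c * coeffs r j) ≗ (pivotCoeff p ∷ᵥ (λ j → c * coeffs r (suc j)))
  c·r≗ zero    = c·r₀≡p
  c·r≗ (suc j) = refl
  c·r·x : ∀ x → (pivotCoeff p ∷ᵥ (λ j → c * coeffs r (suc j))) · x ≡ c * (coeffs r · x)
  c·r·x x = trans (sym (·-congˡ x c·r≗)) (·-scaleˡ c (coeffs r) x)

normalise : ∀ {n} (r : Row (suc n)) → Normalised r
normalise r with <-cmp (coeffs r zero) 0ℚ
... | tri≈ _ r₀≡0 _ = scaleToPivot r 1ℚ 0<1 none (trans (*-identityˡ _) r₀≡0)
... | tri> _ _ r₀>0 =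
  scaleToPivot r _ (recip-pos (pos⇒≢0 r₀>0) r₀>0) up (recip-inverseˡ (coeffs r zero) (pos⇒≢0 r₀>0))
... | tri< r₀<0 _ _ = scaleToPivot r _ (recip-pos (pos⇒≢0 -r₀>0) -r₀>0) down (begin
  c * r₀          ≡⟨ solve 2 (λ c r₀ → c :* r₀ := :- (c :* (:- r₀))) refl c r₀ ⟩
  - (c * (- r₀))  ≡⟨ cong -_ (recip-inverseˡ (- r₀) (pos⇒≢0 -r₀>0)) ⟩
  - 1ℚ            ∎)
  where
  open ≡-Reasoning
  r₀ = coeffs r zero
  -r₀>0 : 0ℚ < - r₀
  -r₀>0 = neg-antimono-< r₀<0
  c = recip (- r₀) (pos⇒≢0 -r₀>0)

record Partition {n} (S : List (Row (suc n))) : Set where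
  field
    zeros ups downs : List (Row n)
    zeros⊢ : All (λ r → S ⊢ 0ℚ ◃ r) zeros
    ups⊢   : All (λ r → S ⊢ 1ℚ ◃ r) ups
    downs⊢ : All (λ r → S ⊢ (- 1ℚ) ◃ r) downs
    covers : ∀ x → All (λ r → x ⊨ 0ℚ ◃ r) zeros → All (λ r → x ⊨ 1ℚ ◃ r) ups →
             All (λ r → x ⊨ (- 1ℚ) ◃ r) downs → All (x ⊨_) S

◃-weaken : ∀ {n} {S : List (Row (suc n))} {r h rs} →
           All (λ r′ → S ⊢ h ◃ r′) rs → All (λ r′ → r ∷ S ⊢ h ◃ r′) rs
◃-weaken = All.map (⊢-mono there)

insert : ∀ {n} {r : Row (suc n)} {S} → Normalised r → Partition S → Partition (r ∷ S)
insert (normalised none r′ derive back) P = record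
  { zeros = r′ ∷ zeros ; ups = ups ; downs = downs
  ; zeros⊢ = derive (hyp (here refl)) ∷ ◃-weaken zeros⊢ ; ups⊢ = ◃-weaken ups⊢ ; downs⊢ = ◃-weaken downs⊢
  ; covers = λ { x (x⊨r′ ∷ z) u d → back x x⊨r′ ∷ covers x z u d } }
  where open Partition P
insert (normalised up r′ derive back) P = record
  { zeros = zeros ; ups = r′ ∷ ups ; downs = downs
  ; zeros⊢ = ◃-weaken zeros⊢ ; ups⊢ = derive (hyp (here refl)) ∷ ◃-weaken ups⊢ ; downs⊢ = ◃-weaken downs⊢
  ; covers = λ { x z (x⊨r′ ∷ u) d → back x x⊨r′ ∷ covers x z u d } }
  where open Partition P
insert (normalised down r′ derive back) P = record
  { zeros = zeros ; ups = ups ; downs = r′ ∷ downs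
  ; zeros⊢ = ◃-weaken zeros⊢ ; ups⊢ = ◃-weaken ups⊢ ; downs⊢ = derive (hyp (here refl)) ∷ ◃-weaken downs⊢
  ; covers = λ { x z u (x⊨r′ ∷ d) → back x x⊨r′ ∷ covers x z u d } }
  where open Partition P

partition : ∀ {n} (S : List (Row (suc n))) → Partition S
partition [] = record
  { zeros = [] ; ups = [] ; downs = [] ; zeros⊢ = [] ; ups⊢ = [] ; downs⊢ = [] ; covers = λ _ _ _ _ → [] }
partition (r ∷ S) = insert (normalise r) (partition S)

_⊕_ : ∀ {n} → Row n → Row n → Row n
r ⊕ r′ = (λ j → coeffs r j + coeffs r′ j) ∣ (rhs r + rhs r′)

eliminate : ∀ {n} {S : List (Row (suc n))} → Partition S → List (Row n)
eliminate P = zeros ++ cartesianProductWith _⊕_ ups downs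
  where open Partition P

eliminate⊢ : ∀ {n} {S : List (Row (suc n))} (P : Partition S) → All (λ r → S ⊢ 0ℚ ◃ r) (eliminate P)
eliminate⊢ P = ++⁺ zeros⊢ (cartesianProductWith⁺ (setoid _) (setoid _) _⊕_ ups downs
  (λ u∈ d∈ → resp pivots-cancel refl (add (All.lookup ups⊢ u∈) (All.lookup downs⊢ d∈))))
  where
  open Partition P
  pivots-cancel : ∀ {a a′ : Fin _ → ℚ} →
                  (λ j → (1ℚ ∷ᵥ a) j + ((- 1ℚ) ∷ᵥ a′) j) ≗ (0ℚ ∷ᵥ (λ j → a j + a′ j))
  pivots-cancel zero    = +-inverseʳ 1ℚ
  pivots-cancel (suc j) = refl

◃0-coneClosed : ∀ {n} (T : List (Row (suc n))) → ConeClosed (λ r → T ⊢ 0ℚ ◃ r)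
◃0-coneClosed T = record
  { add-closed   = λ d d′ → resp (λ { zero → +-identityˡ 0ℚ ; (suc j) → refl }) refl (add d d′)
  ; scale-closed = λ c c≥0 d → resp (λ { zero → *-zeroʳ c ; (suc j) → refl }) refl (scale c c≥0 d)
  ; resp-closed  = λ a≗a′ b≡b′ d → resp (λ { zero → refl ; (suc j) → a≗a′ j }) b≡b′ d
  }

lift-refutation : ∀ {n} {S : List (Row (suc n))} (P : Partition S) → Refutation (eliminate P) → Refutation S
lift-refutation P (b , b<0 , d) =
  b , b<0 , resp (λ { zero → refl ; (suc j) → refl }) refl (⊢-induction (◃0-coneClosed _) (eliminate⊢ P) d)

upperBound lowerBound : ∀ {n} → (Fin n → ℚ) → Row n → ℚ
upperBound x′ r = rhs r - coeffs r · x′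
lowerBound x′ r = coeffs r · x′ - rhs r

⊨-pair⇒lower≤upper : ∀ {n} (x′ : Fin n → ℚ) u d → x′ ⊨ u ⊕ d → lowerBound x′ d ≤ upperBound x′ u
⊨-pair⇒lower≤upper x′ u d x′⊨u⊕d = begin
  s′ - b′                ≡⟨ solve 3 (λ s s′ b′ → s′ :- b′ := (s :+ s′) :+ (:- b′ :- s)) refl s s′ b′ ⟩
  (s + s′) + (- b′ - s)  ≤⟨ +-monoˡ-≤ (- b′ - s) s+s′≤b+b′ ⟩
  (b + b′) + (- b′ - s)  ≡⟨ solve 3 (λ s b b′ → (b :+ b′) :+ (:- b′ :- s) := b :- s) refl s b b′ ⟩
  b - s                  ∎
  where
  open ≤-Reasoning
  s+s′≤b+b′ = subst (_≤ rhs u + rhs d) (·-distribʳ-+ (coeffs u) (coeffs d) x′) x′⊨u⊕d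
  s = coeffs u · x′
  s′ = coeffs d · x′
  b = rhs u
  b′ = rhs d

⊨-none : ∀ {n} (x₀ : ℚ) (x′ : Fin n → ℚ) r → x′ ⊨ r → (x₀ ∷ᵥ x′) ⊨ 0ℚ ◃ r
⊨-none x₀ x′ r x′⊨r =
  subst (_≤ rhs r) (sym (trans (cong (_+ coeffs r · x′) (*-zeroˡ x₀)) (+-identityˡ (coeffs r · x′)))) x′⊨r

⊨-up : ∀ {n} (x₀ : ℚ) (x′ : Fin n → ℚ) r → x₀ ≤ upperBound x′ r → (x₀ ∷ᵥ x′) ⊨ 1ℚ ◃ r
⊨-up x₀ x′ r x₀≤ = begin
  1ℚ * x₀ + s  ≡⟨ cong (_+ s) (*-identityˡ x₀) ⟩
  x₀ + s       ≤⟨ +-monoˡ-≤ s x₀≤ ⟩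
  (b - s) + s  ≡⟨ solve 2 (λ b s → (b :- s) :+ s := b) refl b s ⟩
  b            ∎
  where
  open ≤-Reasoning
  s = coeffs r · x′
  b = rhs r

⊨-down : ∀ {n} (x₀ : ℚ) (x′ : Fin n → ℚ) r → lowerBound x′ r ≤ x₀ →
         (x₀ ∷ᵥ x′) ⊨ (- 1ℚ) ◃ r
⊨-down x₀ x′ r ≤x₀ = begin
  - 1ℚ * x₀ + s     ≡⟨ solve 2 (λ x₀ s → :- con 1ℚ :* x₀ :+ s := :- x₀ :+ s) refl x₀ s ⟩
  - x₀ + s          ≤⟨ +-monoˡ-≤ s (neg-antimono-≤ ≤x₀) ⟩
  - (s - b) + s     ≡⟨ solve 2 (λ b s → :- (s :- b) :+ s := b) refl b s ⟩
  b                 ∎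
  where
  open ≤-Reasoning
  s = coeffs r · x′
  b = rhs r

extend-solution : ∀ {n} {S : List (Row (suc n))} (P : Partition S) → Solution (eliminate P) → Solution S
extend-solution P (x′ , x′⊨) = x₀ ∷ᵥ x′ , covers (x₀ ∷ᵥ x′)
  (All.map (λ {r} → ⊨-none x₀ x′ r) (++⁻ˡ zeros x′⊨))
  (All.tabulate (λ {u} u∈ → ⊨-up x₀ x′ u (max≤v⁺ (min≤upper u∈) (All.map⁺ (All.tabulate (pair-bound u∈))))))
  (All.tabulate (λ {d} d∈ → ⊨-down x₀ x′ d (All.lookup lower≤max d∈)))
  where
  open Partition P
  -- Each pair u ⊕ d says lowerBound d ≤ upperBound u, so the largest lower bound, seeded with the
  -- least upper bound, lies between all of them.
  x₀ = max (min 0ℚ (map (upperBound x′) ups)) (map (lowerBound x′) downs)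
  min≤upper : ∀ {u} → u ∈ ups → min 0ℚ (map (upperBound x′) ups) ≤ upperBound x′ u
  min≤upper = All.lookup (All.map⁻ (min≤xs 0ℚ (map (upperBound x′) ups)))
  lower≤max : All (λ d → lowerBound x′ d ≤ x₀) downs
  lower≤max = All.map⁻ (xs≤max _ (map (lowerBound x′) downs))
  pair-bound : ∀ {u d} → u ∈ ups → d ∈ downs → lowerBound x′ d ≤ upperBound x′ u
  pair-bound {u} {d} u∈ d∈ = ⊨-pair⇒lower≤upper x′ u d
    (All.lookup (++⁻ʳ zeros x′⊨) (∈-cartesianProductWith⁺ _⊕_ u∈ d∈))

fourier-motzkin : ∀ {n} (S : List (Row n)) → Solution S ⊎ Refutation S
fourier-motzkin {zero} [] = inj₁ ((λ ()) , [])
fourier-motzkin {zero} (r ∷ S) with 0ℚ ≤? rhs r | fourier-motzkin S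
... | no  0≰b | _                  = inj₂ (rhs r , ≰⇒> 0≰b , resp (λ ()) refl (hyp (here refl)))
... | yes 0≤b | inj₁ (x , x⊨S)     = inj₁ (x , 0≤b ∷ x⊨S)
... | yes _   | inj₂ (b , b<0 , d) = inj₂ (b , b<0 , ⊢-mono there d)
fourier-motzkin {suc n} S =
  Sum.map (extend-solution P) (lift-refutation P) (fourier-motzkin (eliminate P))
  where P = partition S

solvable? : ∀ {n} (S : List (Row n)) → Dec (Solution S)
solvable? S with fourier-motzkin S
... | inj₁ sol = yes sol
... | inj₂ ref = no (refutation⇒¬solution ref)

negate : ∀ {n} → Row n → Row n
negate r = (λ j → - coeffs r j) ∣ (- rhs r)

asInequalities : ∀ {n} → List (Row n) → List (Row n)
asInequalities []      = []
asInequalities (r ∷ E) = r ∷ negate r ∷ asInequalities E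

asInequalities⁺ : ∀ {n} {P : Row n → Set} E →
                  All (λ r → P r × P (negate r)) E → All P (asInequalities E)
asInequalities⁺ []      []                  = []
asInequalities⁺ (r ∷ E) ((Pr , P-r) ∷ PE) = Pr ∷ P-r ∷ asInequalities⁺ E PE

_⊨⁼_ : ∀ {n} → (Fin n → ℚ) → Row n → Set
x ⊨⁼ r = coeffs r · x ≡ rhs r

⊨-asInequalities⁻ : ∀ {n} {x : Fin n → ℚ} E → All (x ⊨_) (asInequalities E) → All (x ⊨⁼_) E
⊨-asInequalities⁻ [] [] = []
⊨-asInequalities⁻ {x = x} (r ∷ E) (x⊨r ∷ x⊨-r ∷ x⊨E) =
  ≤-antisym x⊨r (neg-cancel-≤ (subst (_≤ - rhs r) (·-negˡ (coeffs r) x) x⊨-r)) ∷ ⊨-asInequalities⁻ E x⊨E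

⊨-asInequalities⁺ : ∀ {n} {x : Fin n → ℚ} E → All (x ⊨⁼_) E → All (x ⊨_) (asInequalities E)
⊨-asInequalities⁺ {x = x} E = asInequalities⁺ E ∘ All.map (λ {r} x⊨r →
  ≤-reflexive x⊨r , ≤-reflexive (trans (·-negˡ (coeffs r) x) (cong -_ x⊨r)))

-- The ratio test

ratio-test : ∀ {n} (x d : Fin n → ℚ) v → (∀ u → 0ℚ ≤ x u) → 0ℚ < d v →
             Σ ℚ λ t → (∀ u → t * d u ≤ x u) × ∃ λ w → 0ℚ < d w × t * d w ≡ x w
ratio-test {n} x d v x≥0 dᵥ>0 = t , t*d≤x , w , dʷ>0 , /?-cancel (x w) (pos⇒≢0 dʷ>0)
  where
  ratio : Fin n → ℚ
  ratio u = x u /? d u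
  candidates = filter (λ u → 0ℚ <? d u) (allFin n)
  w = argmin ratio v candidates
  t = ratio w
  dʷ>0 : 0ℚ < d w
  dʷ>0 = argmin-all ratio dᵥ>0 (all-filter (λ u → 0ℚ <? d u) (allFin n))
  t*d≤x : ∀ u → t * d u ≤ x u
  t*d≤x u = by-cases (0ℚ <? d u)
    where
    by-cases : Dec (0ℚ < d u) → t * d u ≤ x u
    by-cases (yes dᵤ>0) = subst (t * d u ≤_) (/?-cancel (x u) (pos⇒≢0 dᵤ>0))
      (*-monoʳ-≤-nonNeg (d u) {{nonNegative (<⇒≤ dᵤ>0)}} t≤ratio)
      where
      t≤ratio : t ≤ ratio u
      t≤ratio = All.lookup (f[argmin]≤f[xs] v candidates)
                           (∈-filter⁺ (λ u → 0ℚ <? d u) (∈-allFin u) dᵤ>0)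
    by-cases (no dᵤ≯0) = ≤-trans (subst (t * d u ≤_) (*-zeroʳ t)
      (*-monoˡ-≤-nonNeg t {{nonNegative (/?-nonNeg (x≥0 w) dʷ>0)}} (≮⇒≥ dᵤ≯0))) (x≥0 u)

support : ∀ {n} → (Fin n → ℚ) → Subset n
support x = Vec.tabulate (λ u → if does (x u ≟ 0ℚ) then outside else inside)

∈-support⁺ : ∀ {n} {x : Fin n → ℚ} {u} → x u ≢ 0ℚ → u ∈ₛ support x
∈-support⁺ {x = x} {u} xᵤ≢0 = lookup⇒[]= u (support x) (trans (lookup∘tabulate _ u)
  (cong (λ b → if b then outside else inside) (dec-false (x u ≟ 0ℚ) xᵤ≢0)))

∈-support⁻ : ∀ {n} {x : Fin n → ℚ} {u} → u ∈ₛ support x → x u ≢ 0ℚ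
∈-support⁻ {x = x} {u} u∈ xᵤ≡0
  with trans (cong (λ b → if b then outside else inside) (sym (dec-true (x u ≟ 0ℚ) xᵤ≡0)))
             (trans (sym (lookup∘tabulate _ u)) ([]=⇒lookup u∈))
... | ()

sumℚ-tabulate : ∀ {k} (f : Fin k → ℚ) → sumℚ (tabulate f) ≡ sum f
sumℚ-tabulate {zero}  f = refl
sumℚ-tabulate {suc k} f = cong (f zero +_) (sumℚ-tabulate (f ∘ suc))

sumℚ-filter : ∀ {A : Set} {P : A → Set} (P? : Decidable P) (f : A → ℚ) xs →
              sumℚ (map f (filter P? xs)) ≡ sumℚ (map (λ x → 𝟙 (does (P? x)) * f x) xs)
sumℚ-filter P? f [] = refl
sumℚ-filter P? f (x ∷ xs) with does (P? x)
... | false = trans (sumℚ-filter P? f xs) (sym (trans (cong (_+ rest) (*-zeroˡ (f x))) (+-identityˡ rest)))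
  where rest = sumℚ (map (λ x → 𝟙 (does (P? x)) * f x) xs)
... | true  = cong₂ _+_ (sym (*-identityˡ (f x))) (sumℚ-filter P? f xs)

toℚ-length-filter : ∀ {A : Set} {P : A → Set} (P? : Decidable P) xs →
                    toℚ (length (filter P? xs)) ≡ sumℚ (map (λ x → 𝟙 (does (P? x))) xs)
toℚ-length-filter P? [] = refl
toℚ-length-filter P? (x ∷ xs) with does (P? x)
... | false = trans (toℚ-length-filter P? xs) (sym (+-identityˡ _))
... | true  = trans (toℚ-suc (length (filter P? xs))) (cong (1ℚ +_) (toℚ-length-filter P? xs))

≤-foldr-⊔ : ∀ {A : Set} {k} (g : Fin k → A) (f : A → ℕ) i →
            f (g i) ℕ.≤ foldr ℕ._⊔_ 0 (map f (tabulate g))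
≤-foldr-⊔ g f zero    = ℕ.m≤m⊔n _ _
≤-foldr-⊔ g f (suc i) = ℕ.≤-trans (≤-foldr-⊔ (g ∘ suc) f i) (ℕ.m≤n⊔m (f (g zero)) _)

χ : ∀ {r n} (F : RGraph r n) → Edge F → Fin n → ℚ
χ F i u = 𝟙 (does (u ∈? edge F i))

χ-nonNeg : ∀ {r n} (F : RGraph r n) i u → 0ℚ ≤ χ F i u
χ-nonNeg F i u = 𝟙-nonNeg (does (u ∈? edge F i))

sumℚ-filter-allFin : ∀ {k} {P : Fin k → Set} (P? : Decidable P) (f : Fin k → ℚ) →
                     sumℚ (map f (filter P? (allFin k))) ≡ ∑[ i < k ] (𝟙 (does (P? i)) * f i)
sumℚ-filter-allFin {k} P? f = trans (sumℚ-filter P? f (allFin k))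
  (trans (cong sumℚ (map-tabulate id g)) (sumℚ-tabulate g))
  where
  g : Fin k → ℚ
  g i = 𝟙 (does (P? i)) * f i

edgeSum-≡-∑ : ∀ {r n} (F : RGraph r n) (lab : Fin n → ℚ) i →
              edgeSum lab (edge F i) ≡ ∑[ u < n ] (χ F i u * lab u)
edgeSum-≡-∑ F lab i = sumℚ-filter-allFin (_∈? edge F i) lab

vertexLoad-≡-∑ : ∀ {r n} (F : RGraph r n) (w : Edge F → ℚ) u →
                 vertexLoad F w u ≡ ∑[ i < numEdges F ] (χ F i u * w i)
vertexLoad-≡-∑ F w u = sumℚ-filter-allFin (λ i → u ∈? edge F i) w

weight-≡-∑ : ∀ {r n} (F : RGraph r n) (w : Edge F → ℚ) → weight F w ≡ sum w
weight-≡-∑ F w = trans (cong sumℚ (map-tabulate id w)) (sumℚ-tabulate w)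

deg-≡-∑ : ∀ {r n} (F : RGraph r n) u → toℚ (deg F u) ≡ ∑[ i < numEdges F ] χ F i u
deg-≡-∑ F u = begin
  toℚ (deg F u)                          ≡⟨ toℚ-length-filter (u ∈?_) (edges F) ⟩
  sumℚ (map u∈ (edges F))                ≡⟨ cong (sumℚ ∘ map u∈) (sym (tabulate-lookup (edges F))) ⟩
  sumℚ (map u∈ (tabulate (edge F)))      ≡⟨ cong sumℚ (map-tabulate (edge F) u∈) ⟩
  sumℚ (tabulate (λ i → χ F i u))        ≡⟨ sumℚ-tabulate (λ i → χ F i u) ⟩
  ∑[ i < numEdges F ] χ F i u            ∎
  where
  open ≡-Reasoning
  u∈ : Subset _ → ℚ
  u∈ e = 𝟙 (does (u ∈? e))

deg≤Δ : ∀ {r n} (F : RGraph r n) u → deg F u ℕ.≤ Δ F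
deg≤Δ F = ≤-foldr-⊔ id (deg F)

NumEdges≡Δν* : ∀ {r n} → RGraph r n → Set
NumEdges≡Δν* F = Σ ℚ λ ν → IsNuStar F ν × (toℚ (numEdges F) ≡ toℚ (Δ F) * ν)

-- Strictness forces the bound λ ≤ 1 of a labeling once Δ > 0 (see strictLabeling⇒labeling).
record IsStrictLabeling {r n} (F : RGraph r n) (lab : Fin n → ℚ) : Set where
  field
    nonNeg   : ∀ u → 0ℚ ≤ lab u
    vanishes : ∀ u → deg F u ℕ.< Δ F → lab u ≡ 0ℚ
    sums≡1   : IsStrict F lab

labeling⇒strictLabeling : ∀ {r n} (F : RGraph r n) {lab} →
                          IsLabeling F lab → IsStrict F lab → IsStrictLabeling F lab
labeling⇒strictLabeling F (bounds , _ , vanishes) strict = record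
  { nonNeg = proj₁ ∘ bounds ; vanishes = vanishes ; sums≡1 = strict }

module _ {r n} (F : RGraph r n) where

  m : ℕ
  m = numEdges F

  strict⇒∑≡1 : ∀ {lab : Fin n → ℚ} → IsStrict F lab → ∀ i → ∑[ u < n ] (χ F i u * lab u) ≡ 1ℚ
  strict⇒∑≡1 {lab} strict i = trans (sym (edgeSum-≡-∑ F lab i)) (strict i)

  nonzero⇒maxDegree : ∀ {lab : Fin n → ℚ} → (∀ u → deg F u ℕ.< Δ F → lab u ≡ 0ℚ) →
                      ∀ u → lab u ≢ 0ℚ → deg F u ≡ Δ F
  nonzero⇒maxDegree vanishes u lab≢0 = ℕ.≤-antisym (deg≤Δ F u) (ℕ.≮⇒≥ (lab≢0 ∘ vanishes u))

  lab*deg≡lab*Δ : ∀ (lab : Fin n → ℚ) → (∀ u → deg F u ℕ.< Δ F → lab u ≡ 0ℚ) →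
                  ∀ u → lab u * toℚ (deg F u) ≡ lab u * toℚ (Δ F)
  lab*deg≡lab*Δ lab vanishes u = by-cases (lab u ≟ 0ℚ)
    where
    by-cases : Dec (lab u ≡ 0ℚ) → lab u * toℚ (deg F u) ≡ lab u * toℚ (Δ F)
    by-cases (yes lab≡0) = begin
      lab u * toℚ (deg F u)   ≡⟨ cong (_* toℚ (deg F u)) lab≡0 ⟩
      0ℚ * toℚ (deg F u)      ≡⟨ *-zeroˡ (toℚ (deg F u)) ⟩
      0ℚ                      ≡⟨ sym (*-zeroˡ (toℚ (Δ F))) ⟩
      0ℚ * toℚ (Δ F)          ≡⟨ cong (_* toℚ (Δ F)) (sym lab≡0) ⟩
      lab u * toℚ (Δ F)       ∎
      where open ≡-Reasoning
    by-cases (no lab≢0) = cong (λ k → lab u * toℚ k) (nonzero⇒maxDegree {lab} vanishes u lab≢0)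

  vertexLoad-one : ∀ u → vertexLoad F (λ _ → 1ℚ) u ≡ toℚ (deg F u)
  vertexLoad-one u = trans (vertexLoad-≡-∑ F (λ _ → 1ℚ) u)
    (trans (sum-cong-≗ (λ i → *-identityʳ (χ F i u))) (sym (deg-≡-∑ F u)))

  double-counting : ∀ (w : Edge F → ℚ) (lab : Fin n → ℚ) →
                    ∑[ i < m ] (w i * edgeSum lab (edge F i)) ≡ ∑[ u < n ] (lab u * vertexLoad F w u)
  double-counting w lab = begin
    ∑[ i < m ] (w i * edgeSum lab (edge F i))
      ≡⟨ sum-cong-≗ (λ i → cong (w i *_) (edgeSum-≡-∑ F lab i)) ⟩
    ∑[ i < m ] (w i * ∑[ u < n ] (χ F i u * lab u))
      ≡⟨ sum-cong-≗ (λ i → *-distribˡ-sum (w i) (λ u → χ F i u * lab u)) ⟩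
    ∑[ i < m ] ∑[ u < n ] (w i * (χ F i u * lab u))
      ≡⟨ ∑-comm (λ i u → w i * (χ F i u * lab u)) ⟩
    ∑[ u < n ] ∑[ i < m ] (w i * (χ F i u * lab u))
      ≡⟨ sum-cong-≗ (λ u → sum-cong-≗ (λ i → swap (w i) (χ F i u) (lab u))) ⟩
    ∑[ u < n ] ∑[ i < m ] (lab u * (χ F i u * w i))
      ≡⟨ sum-cong-≗ (λ u → sym (*-distribˡ-sum (lab u) (λ i → χ F i u * w i))) ⟩
    ∑[ u < n ] (lab u * ∑[ i < m ] (χ F i u * w i))
      ≡⟨ sum-cong-≗ (λ u → cong (lab u *_) (sym (vertexLoad-≡-∑ F w u))) ⟩
    ∑[ u < n ] (lab u * vertexLoad F w u)
      ∎
    where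
    open ≡-Reasoning
    swap : ∀ w χ l → w * (χ * l) ≡ l * (χ * w)
    swap = solve 3 (λ w χ l → w :* (χ :* l) := l :* (χ :* w)) refl

  numEdges≡Δ*∑ : ∀ {lab : Fin n → ℚ} → IsStrictLabeling F lab → toℚ m ≡ toℚ (Δ F) * sum lab
  numEdges≡Δ*∑ {lab} isStrict = begin
    toℚ m                                            ≡⟨ sym (trans (∑-const {m} 1ℚ) (*-identityʳ (toℚ m))) ⟩
    ∑[ i < m ] 1ℚ                                    ≡⟨ sum-cong-≗ (sym ∘ 1*edgeSum≡1) ⟩
    ∑[ i < m ] (1ℚ * edgeSum lab (edge F i))         ≡⟨ double-counting (λ _ → 1ℚ) lab ⟩
    ∑[ u < n ] (lab u * vertexLoad F (λ _ → 1ℚ) u)   ≡⟨ sum-cong-≗ (λ u → cong (lab u *_) (vertexLoad-one u)) ⟩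
    ∑[ u < n ] (lab u * toℚ (deg F u))               ≡⟨ sum-cong-≗ (lab*deg≡lab*Δ lab vanishes) ⟩
    ∑[ u < n ] (lab u * toℚ (Δ F))                   ≡⟨ sym (*-distribʳ-sum (toℚ (Δ F)) lab) ⟩
    sum lab * toℚ (Δ F)                              ≡⟨ *-comm (sum lab) (toℚ (Δ F)) ⟩
    toℚ (Δ F) * sum lab                              ∎
    where
    open ≡-Reasoning
    open IsStrictLabeling isStrict
    1*edgeSum≡1 : ∀ i → 1ℚ * edgeSum lab (edge F i) ≡ 1ℚ
    1*edgeSum≡1 i = trans (*-identityˡ (edgeSum lab (edge F i))) (sums≡1 i)

  weak-duality : ∀ {lab : Fin n → ℚ} {w} → (∀ u → 0ℚ ≤ lab u) →
                 (∀ i → 1ℚ ≤ edgeSum lab (edge F i)) → IsFracMatching F w → weight F w ≤ sum lab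
  weak-duality {lab} {w} lab≥0 covers (w≥0 , load≤1) = begin
    weight F w                                  ≡⟨ weight-≡-∑ F w ⟩
    ∑[ i < m ] w i                              ≤⟨ ∑-mono-≤ w≤w*edgeSum ⟩
    ∑[ i < m ] (w i * edgeSum lab (edge F i))   ≡⟨ double-counting w lab ⟩
    ∑[ u < n ] (lab u * vertexLoad F w u)       ≤⟨ ∑-mono-≤ lab*load≤lab ⟩
    sum lab                                     ∎
    where
    open ≤-Reasoning
    w≤w*edgeSum : ∀ i → w i ≤ w i * edgeSum lab (edge F i)
    w≤w*edgeSum i = subst (_≤ w i * edgeSum lab (edge F i)) (*-identityʳ (w i))
      (*-monoˡ-≤-nonNeg (w i) {{nonNegative (w≥0 i)}} (covers i))
    lab*load≤lab : ∀ u → lab u * vertexLoad F w u ≤ lab u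
    lab*load≤lab u = subst (lab u * vertexLoad F w u ≤_) (*-identityʳ (lab u))
      (*-monoˡ-≤-nonNeg (lab u) {{nonNegative (lab≥0 u)}} (load≤1 u))

  uniformMatching : ∀ (Δ>0 : 0ℚ < toℚ (Δ F)) → IsFracMatching F (λ _ → recip (toℚ (Δ F)) (pos⇒≢0 Δ>0))
  uniformMatching Δ>0 = (λ _ → c≥0) , λ u → begin
    vertexLoad F (λ _ → c) u       ≡⟨ vertexLoad-≡-∑ F (λ _ → c) u ⟩
    ∑[ i < m ] (χ F i u * c)       ≡⟨ sym (*-distribʳ-sum c (λ i → χ F i u)) ⟩
    (∑[ i < m ] χ F i u) * c       ≡⟨ cong (_* c) (sym (deg-≡-∑ F u)) ⟩
    toℚ (deg F u) * c              ≤⟨ *-monoʳ-≤-nonNeg c {{nonNegative c≥0}} (toℚ-mono-≤ (deg≤Δ F u)) ⟩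
    toℚ (Δ F) * c                  ≡⟨ *-comm (toℚ (Δ F)) c ⟩
    c * toℚ (Δ F)                  ≡⟨ recip-inverseˡ (toℚ (Δ F)) (pos⇒≢0 Δ>0) ⟩
    1ℚ                             ∎
    where
    open ≤-Reasoning
    c = recip (toℚ (Δ F)) (pos⇒≢0 Δ>0)
    c≥0 : 0ℚ ≤ c
    c≥0 = <⇒≤ (recip-pos (pos⇒≢0 Δ>0) Δ>0)

  noEdges⇒ν*≡0 : m ≡ 0 → IsNuStar F 0ℚ
  noEdges⇒ν*≡0 m≡0 =
    ((λ _ → 0ℚ) , ((λ _ → ≤-refl) , load≤1) , weight≡0 _) , λ w _ → ≤-reflexive (weight≡0 w)
    where
    ∑-empty : ∀ {k} → k ≡ 0 → (f : Fin k → ℚ) → sum f ≡ 0ℚ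
    ∑-empty refl f = refl
    weight≡0 : ∀ w → weight F w ≡ 0ℚ
    weight≡0 w = trans (weight-≡-∑ F w) (∑-empty m≡0 w)
    load≤1 : ∀ u → vertexLoad F (λ _ → 0ℚ) u ≤ 1ℚ
    load≤1 u = subst (_≤ 1ℚ) (sym (trans (vertexLoad-≡-∑ F _ u) (∑-empty m≡0 _))) (<⇒≤ 0<1)

  strictLabeling⇒numEdges≡Δν* : ∀ {lab : Fin n → ℚ} → IsStrictLabeling F lab → NumEdges≡Δν* F
  strictLabeling⇒numEdges≡Δν* {lab} isStrict = [ Δ≡0-case , Δ>0-case ]′ (toℚ-zero-or-pos (Δ F))
    where
    open IsStrictLabeling isStrict
    Δ≡0-case : Δ F ≡ 0 → NumEdges≡Δν* F
    Δ≡0-case Δ≡0 = 0ℚ , noEdges⇒ν*≡0 m≡0 , trans (cong toℚ m≡0) (sym (*-zeroʳ (toℚ (Δ F))))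
      where
      m≡0 : m ≡ 0
      m≡0 = toℚ≡0⇒≡0 (trans (numEdges≡Δ*∑ isStrict)
                            (trans (cong (λ k → toℚ k * sum lab) Δ≡0) (*-zeroˡ (sum lab))))
    Δ>0-case : 0ℚ < toℚ (Δ F) → NumEdges≡Δν* F
    Δ>0-case Δ>0 =
      sum lab , ((w , uniformMatching Δ>0 , weight≡∑) , λ _ → weak-duality nonNeg covers) , numEdges≡Δ*∑ isStrict
      where
      covers : ∀ i → 1ℚ ≤ edgeSum lab (edge F i)
      covers = ≤-reflexive ∘ sym ∘ sums≡1
      c = recip (toℚ (Δ F)) (pos⇒≢0 Δ>0)
      w : Edge F → ℚ
      w _ = c
      weight≡∑ : weight F w ≡ sum lab
      weight≡∑ = begin
        weight F w                      ≡⟨ trans (weight-≡-∑ F w) (∑-const {m} c) ⟩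
        toℚ m * c                       ≡⟨ cong (_* c) (numEdges≡Δ*∑ isStrict) ⟩
        toℚ (Δ F) * sum lab * c         ≡⟨ solve 3 (λ Δ s c → Δ :* s :* c := s :* (c :* Δ)) refl (toℚ (Δ F)) (sum lab) c ⟩
        sum lab * (c * toℚ (Δ F))       ≡⟨ cong (sum lab *_) (recip-inverseˡ (toℚ (Δ F)) (pos⇒≢0 Δ>0)) ⟩
        sum lab * 1ℚ                    ≡⟨ *-identityʳ (sum lab) ⟩
        sum lab                         ∎
        where open ≡-Reasoning

  -- Existence of a strict labeling

  lowDegree : Fin n → ℚ
  lowDegree u = 𝟙 (does (deg F u ℕ.<? Δ F))

  lowDegree-max : ∀ u → deg F u ≡ Δ F → lowDegree u ≡ 0ℚ
  lowDegree-max u deg≡Δ = cong 𝟙 (dec-false (deg F u ℕ.<? Δ F) (λ deg<Δ → ℕ.<⇒≢ deg<Δ deg≡Δ))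

  -- The row for u in the middle block reads x_u ≤ 0 when u has low degree and 0 ≤ 0 otherwise.
  nonNegRows lowDegreeRows edgeEquations : List (Row n)
  nonNegRows     = tabulate (λ u → (λ t → - δ u t) ∣ 0ℚ)
  lowDegreeRows  = tabulate (λ u → (λ t → lowDegree u * δ u t) ∣ 0ℚ)
  edgeEquations  = tabulate (λ i → χ F i ∣ 1ℚ)

  strictLabelingLP : List (Row n)
  strictLabelingLP = nonNegRows ++ lowDegreeRows ++ asInequalities edgeEquations

  solution⇒strictLabeling : Solution strictLabelingLP → Σ (Fin n → ℚ) (IsStrictLabeling F)
  solution⇒strictLabeling (x , x⊨) = x , record { nonNeg = nonNeg ; vanishes = vanishes ; sums≡1 = strict }
    where
    x⊨low   = ++⁻ʳ nonNegRows x⊨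
    nonNeg : ∀ u → 0ℚ ≤ x u
    nonNeg u = neg-cancel-≤ (subst (_≤ 0ℚ) (trans (·-negˡ (δ u) x) (cong -_ (∑-δ u x)))
                                         (All.tabulate⁻ (++⁻ˡ nonNegRows x⊨) u))
    lowDegree*x≤0 : ∀ u → lowDegree u * x u ≤ 0ℚ
    lowDegree*x≤0 u = subst (_≤ 0ℚ) (trans (·-scaleˡ (lowDegree u) (δ u) x) (cong (lowDegree u *_) (∑-δ u x)))
      (All.tabulate⁻ (++⁻ˡ lowDegreeRows x⊨low) u)
    vanishes : ∀ u → deg F u ℕ.< Δ F → x u ≡ 0ℚ
    vanishes u deg<Δ = ≤-antisym (subst (_≤ 0ℚ) low*x≡x (lowDegree*x≤0 u)) (nonNeg u)
      where
      low*x≡x : lowDegree u * x u ≡ x u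
      low*x≡x = trans (cong (λ b → 𝟙 b * x u) (dec-true (deg F u ℕ.<? Δ F) deg<Δ)) (*-identityˡ (x u))
    strict : IsStrict F x
    strict i = trans (edgeSum-≡-∑ F x i)
      (All.tabulate⁻ (⊨-asInequalities⁻ edgeEquations (++⁻ʳ lowDegreeRows x⊨low)) i)

  vertexLoad-+ : ∀ (y y′ : Edge F → ℚ) u →
                 vertexLoad F (λ i → y i + y′ i) u ≡ vertexLoad F y u + vertexLoad F y′ u
  vertexLoad-+ y y′ u = begin
    vertexLoad F (λ i → y i + y′ i) u
      ≡⟨ vertexLoad-≡-∑ F _ u ⟩
    ∑[ i < m ] (χ F i u * (y i + y′ i))
      ≡⟨ sum-cong-≗ (λ i → *-distribˡ-+ (χ F i u) (y i) (y′ i)) ⟩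
    ∑[ i < m ] (χ F i u * y i + χ F i u * y′ i)
      ≡⟨ ∑-distrib-+ (λ i → χ F i u * y i) (λ i → χ F i u * y′ i) ⟩
    ∑[ i < m ] (χ F i u * y i) + ∑[ i < m ] (χ F i u * y′ i)
      ≡⟨ sym (cong₂ _+_ (vertexLoad-≡-∑ F y u) (vertexLoad-≡-∑ F y′ u)) ⟩
    vertexLoad F y u + vertexLoad F y′ u
      ∎
    where open ≡-Reasoning

  vertexLoad-scale : ∀ c (y : Edge F → ℚ) u → vertexLoad F (λ i → c * y i) u ≡ c * vertexLoad F y u
  vertexLoad-scale c y u = begin
    vertexLoad F (λ i → c * y i) u     ≡⟨ vertexLoad-≡-∑ F _ u ⟩
    ∑[ i < m ] (χ F i u * (c * y i))   ≡⟨ sum-cong-≗ (λ i → swap (χ F i u) c (y i)) ⟩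
    ∑[ i < m ] (c * (χ F i u * y i))   ≡⟨ sym (*-distribˡ-sum c (λ i → χ F i u * y i)) ⟩
    c * ∑[ i < m ] (χ F i u * y i)     ≡⟨ cong (c *_) (sym (vertexLoad-≡-∑ F y u)) ⟩
    c * vertexLoad F y u               ∎
    where
    open ≡-Reasoning
    swap : ∀ χ c y → χ * (c * y) ≡ c * (χ * y)
    swap = solve 3 (λ χ c y → χ :* (c :* y) := c :* (χ :* y)) refl

  vertexLoad-δ : ∀ i u → vertexLoad F (δ i) u ≡ χ F i u
  vertexLoad-δ i u = trans (vertexLoad-≡-∑ F (δ i) u)
    (trans (sum-cong-≗ (λ j → *-comm (χ F j u) (δ i j))) (∑-δ i (λ j → χ F j u)))

  vertexLoad-zero : ∀ u → vertexLoad F (λ _ → 0ℚ) u ≡ 0ℚ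
  vertexLoad-zero u = trans (vertexLoad-scale 0ℚ (λ _ → 0ℚ) u) (*-zeroˡ (vertexLoad F (λ _ → 0ℚ) u))

  LoadNonNegAtΔ : (Edge F → ℚ) → Set
  LoadNonNegAtΔ y = ∀ u → deg F u ≡ Δ F → 0ℚ ≤ vertexLoad F y u

  -- Every consequence a · x ≤ b of strictLabelingLP has such a witness y; for a refutation
  -- (a = 0, b < 0) it is a dual ray improving on the matching 1/Δ.
  DualBound : Row n → Set
  DualBound r = Σ (Edge F → ℚ) λ y →
    sum y ≤ rhs r × (∀ u → deg F u ≡ Δ F → coeffs r u ≤ vertexLoad F y u)

  dualBound-coneClosed : ConeClosed DualBound
  dualBound-coneClosed = record { add-closed = add-closed ; scale-closed = scale-closed ; resp-closed = resp-closed }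
    where
    add-closed : ∀ {a b a′ b′} → DualBound (a ∣ b) → DualBound (a′ ∣ b′) →
                 DualBound ((λ j → a j + a′ j) ∣ (b + b′))
    add-closed {a} {b} {a′} {b′} (y , ∑y≤b , a≤) (y′ , ∑y′≤b′ , a′≤) =
      (λ i → y i + y′ i) ,
      subst (_≤ b + b′) (sym (∑-distrib-+ y y′)) (+-mono-≤ ∑y≤b ∑y′≤b′) ,
      λ u max → subst (a u + a′ u ≤_) (sym (vertexLoad-+ y y′ u)) (+-mono-≤ (a≤ u max) (a′≤ u max))
    scale-closed : ∀ {a b} c → 0ℚ ≤ c → DualBound (a ∣ b) → DualBound ((λ j → c * a j) ∣ (c * b))
    scale-closed {a} {b} c c≥0 (y , ∑y≤b , a≤) =
      (λ i → c * y i) ,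
      subst (_≤ c * b) (*-distribˡ-sum c y) (*-monoˡ-≤-nonNeg c {{nonNegative c≥0}} ∑y≤b) ,
      λ u max → subst (c * a u ≤_) (sym (vertexLoad-scale c y u))
                      (*-monoˡ-≤-nonNeg c {{nonNegative c≥0}} (a≤ u max))
    resp-closed : ∀ {a b a′ b′} → a ≗ a′ → b ≡ b′ → DualBound (a ∣ b) → DualBound (a′ ∣ b′)
    resp-closed {a} {b} a≗a′ b≡b′ (y , ∑y≤b , a≤) =
      y , subst (sum y ≤_) b≡b′ ∑y≤b , λ u max → subst (_≤ vertexLoad F y u) (a≗a′ u) (a≤ u max)

  dualBounds : All DualBound strictLabelingLP
  dualBounds = ++⁺ (All.tabulate⁺ nonNegRow) (++⁺ (All.tabulate⁺ lowDegreeRow)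
    (asInequalities⁺ edgeEquations (All.tabulate⁺ (λ i → edgeRow i , negatedEdgeRow i))))
    where
    zeroBound : ∀ {a : Fin n → ℚ} → (∀ u → deg F u ≡ Δ F → a u ≤ 0ℚ) → DualBound (a ∣ 0ℚ)
    zeroBound {a} a≤0 = (λ _ → 0ℚ) , ≤-reflexive (∑-zero {m}) ,
      λ u max → subst (a u ≤_) (sym (vertexLoad-zero u)) (a≤0 u max)
    nonNegRow : ∀ u → DualBound ((λ t → - δ u t) ∣ 0ℚ)
    nonNegRow u = zeroBound (λ t _ → neg-antimono-≤ (𝟙-nonNeg (does (u ≟ᶠ t))))
    lowDegreeRow : ∀ u → DualBound ((λ t → lowDegree u * δ u t) ∣ 0ℚ)
    lowDegreeRow u = zeroBound low≤0
      where
      low≤0 : ∀ t → deg F t ≡ Δ F → lowDegree u * δ u t ≤ 0ℚ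
      low≤0 t max with u ≟ᶠ t
      ... | yes refl = ≤-reflexive (trans (cong (_* 1ℚ) (lowDegree-max u max)) (*-zeroˡ 1ℚ))
      ... | no  _    = ≤-reflexive (*-zeroʳ (lowDegree u))
    edgeRow : ∀ i → DualBound (χ F i ∣ 1ℚ)
    edgeRow i = δ i , ≤-reflexive (∑-δ-const i) , λ u _ → ≤-reflexive (sym (vertexLoad-δ i u))
    negatedEdgeRow : ∀ i → DualBound (negate (χ F i ∣ 1ℚ))
    negatedEdgeRow i = (λ j → - 1ℚ * δ i j) , ≤-reflexive ∑-δ-neg , λ u _ → ≤-reflexive (sym (load≡ u))
      where
      ∑-δ-neg : ∑[ j < m ] (- 1ℚ * δ i j) ≡ - 1ℚ
      ∑-δ-neg = trans (sym (*-distribˡ-sum (- 1ℚ) (δ i))) (trans (cong (- 1ℚ *_) (∑-δ-const i)) (*-identityʳ (- 1ℚ)))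
      load≡ : ∀ u → vertexLoad F (λ j → - 1ℚ * δ i j) u ≡ - χ F i u
      load≡ u = trans (vertexLoad-scale (- 1ℚ) (δ i) u)
        (trans (cong (- 1ℚ *_) (vertexLoad-δ i u)) (solve 1 (λ p → :- con 1ℚ :* p := :- p) refl (χ F i u)))

  refutation⇒dualRay : Refutation strictLabelingLP → Σ (Edge F → ℚ) λ y → sum y < 0ℚ × LoadNonNegAtΔ y
  refutation⇒dualRay (b , b<0 , d) =
    let y , ∑y≤b , 0≤load = ⊢-induction dualBound-coneClosed dualBounds d
    in  y , ≤-<-trans ∑y≤b b<0 , 0≤load

  -- w = (M - y)/(ΔM) with M = 1 + Σ|y|: M dominates every y_i and every -load_y(u), so w ≥ 0 and
  -- only vertices of maximum degree, where load_y ≥ 0, could exceed load 1.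
  perturbedMatching : 0ℚ < toℚ (Δ F) → ∀ y → LoadNonNegAtΔ y →
    Σ (Edge F → ℚ) λ w → IsFracMatching F w × Σ ℚ λ M → 0ℚ < M × toℚ (Δ F) * M * weight F w ≡ toℚ m * M - sum y
  perturbedMatching Δ>0 y load≥0 = w , (w≥0 , load≤1) , M , M>0 , weight-eq
    where
    open ≤-Reasoning
    A = ∑[ i < m ] ∣ y i ∣
    M = 1ℚ + A
    A≤M : A ≤ M
    A≤M = subst (_≤ M) (+-identityˡ A) (+-monoˡ-≤ A (<⇒≤ 0<1))
    M>0 : 0ℚ < M
    M>0 = <-≤-trans 0<1 (subst (_≤ M) (+-identityʳ 1ℚ) (+-monoʳ-≤ 1ℚ (∑-nonNeg (λ i → 0≤∣p∣ (y i)))))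
    ΔM>0 : 0ℚ < toℚ (Δ F) * M
    ΔM>0 = *-pos Δ>0 M>0
    c = recip (toℚ (Δ F) * M) (pos⇒≢0 ΔM>0)
    c≥0 : 0ℚ ≤ c
    c≥0 = <⇒≤ (recip-pos (pos⇒≢0 ΔM>0) ΔM>0)
    w : Edge F → ℚ
    w i = c * (M - y i)
    w≥0 : ∀ i → 0ℚ ≤ w i
    w≥0 i = *-nonNeg c≥0 (p≤q⇒0≤q-p (≤-trans (p≤∣p∣ (y i)) (≤-trans (term≤∑ (0≤∣p∣ ∘ y) i) A≤M)))
    -load≤M : ∀ u → - vertexLoad F y u ≤ M
    -load≤M u = begin
      - vertexLoad F y u                  ≡⟨ cong -_ (vertexLoad-≡-∑ F y u) ⟩
      - ∑[ i < m ] (χ F i u * y i)        ≡⟨ sym (∑-neg (λ i → χ F i u * y i)) ⟩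
      ∑[ i < m ] (- (χ F i u * y i))      ≤⟨ ∑-mono-≤ (λ i → -[𝟙*p]≤∣p∣ (does (u ∈? edge F i)) (y i)) ⟩
      A                                   ≤⟨ A≤M ⟩
      M                                   ∎
    load≡ : ∀ u → vertexLoad F w u ≡ c * (M * toℚ (deg F u) - vertexLoad F y u)
    load≡ u = begin-equality
      vertexLoad F w u
        ≡⟨ vertexLoad-≡-∑ F w u ⟩
      ∑[ i < m ] (χ F i u * (c * (M - y i)))
        ≡⟨ sum-cong-≗ (λ i → expand (χ F i u) (y i)) ⟩
      ∑[ i < m ] (c * (M * χ F i u - χ F i u * y i))
        ≡⟨ sym (*-distribˡ-sum c (λ i → M * χ F i u - χ F i u * y i)) ⟩
      c * ∑[ i < m ] (M * χ F i u - χ F i u * y i)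
        ≡⟨ cong (c *_) (∑-sub (λ i → M * χ F i u) (λ i → χ F i u * y i)) ⟩
      c * (∑[ i < m ] (M * χ F i u) - ∑[ i < m ] (χ F i u * y i))
        ≡⟨ cong (λ s → c * (s - ∑[ i < m ] (χ F i u * y i))) (sym (*-distribˡ-sum M (λ i → χ F i u))) ⟩
      c * (M * ∑[ i < m ] χ F i u - ∑[ i < m ] (χ F i u * y i))
        ≡⟨ cong (c *_) (cong₂ _-_ (cong (M *_) (sym (deg-≡-∑ F u))) (sym (vertexLoad-≡-∑ F y u))) ⟩
      c * (M * toℚ (deg F u) - vertexLoad F y u)
        ∎
      where
      expand : ∀ χ y → χ * (c * (M - y)) ≡ c * (M * χ - χ * y)
      expand = solve 4 (λ c M χ y → χ :* (c :* (M :- y)) := c :* (M :* χ :- χ :* y)) refl c M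
    bound : ∀ u → M * toℚ (deg F u) - vertexLoad F y u ≤ toℚ (Δ F) * M
    bound u = by-cases (deg F u ℕ.<? Δ F)
      where
      by-cases : Dec (deg F u ℕ.< Δ F) → M * toℚ (deg F u) - vertexLoad F y u ≤ toℚ (Δ F) * M
      by-cases (yes deg<Δ) = begin
        M * toℚ (deg F u) - vertexLoad F y u     ≤⟨ +-monoʳ-≤ (M * toℚ (deg F u)) (-load≤M u) ⟩
        M * toℚ (deg F u) + M                    ≡⟨ solve 2 (λ M d → M :* d :+ M := M :* (con 1ℚ :+ d)) refl M _ ⟩
        M * (1ℚ + toℚ (deg F u))                 ≡⟨ cong (M *_) (sym (toℚ-suc (deg F u))) ⟩
        M * toℚ (suc (deg F u))                  ≤⟨ *-monoˡ-≤-nonNeg M {{nonNegative (<⇒≤ M>0)}} (toℚ-mono-≤ deg<Δ) ⟩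
        M * toℚ (Δ F)                            ≡⟨ *-comm M (toℚ (Δ F)) ⟩
        toℚ (Δ F) * M                            ∎
      by-cases (no deg≮Δ) = begin
        M * toℚ (deg F u) - vertexLoad F y u     ≤⟨ +-monoʳ-≤ (M * toℚ (deg F u)) -load≤0 ⟩
        M * toℚ (deg F u) + 0ℚ                   ≡⟨ +-identityʳ (M * toℚ (deg F u)) ⟩
        M * toℚ (deg F u)                        ≡⟨ cong (λ k → M * toℚ k) deg≡Δ ⟩
        M * toℚ (Δ F)                            ≡⟨ *-comm M (toℚ (Δ F)) ⟩
        toℚ (Δ F) * M                            ∎
        where
        deg≡Δ : deg F u ≡ Δ F
        deg≡Δ = ℕ.≤-antisym (deg≤Δ F u) (ℕ.≮⇒≥ deg≮Δ)
        -load≤0 : - vertexLoad F y u ≤ 0ℚ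
        -load≤0 = neg-antimono-≤ (load≥0 u deg≡Δ)
    load≤1 : ∀ u → vertexLoad F w u ≤ 1ℚ
    load≤1 u = begin
      vertexLoad F w u                               ≡⟨ load≡ u ⟩
      c * (M * toℚ (deg F u) - vertexLoad F y u)     ≤⟨ *-monoˡ-≤-nonNeg c {{nonNegative c≥0}} (bound u) ⟩
      c * (toℚ (Δ F) * M)                            ≡⟨ recip-inverseˡ (toℚ (Δ F) * M) (pos⇒≢0 ΔM>0) ⟩
      1ℚ                                             ∎
    weight-eq : toℚ (Δ F) * M * weight F w ≡ toℚ m * M - sum y
    weight-eq = begin-equality
      ΔM * weight F w                      ≡⟨ cong (ΔM *_) (weight-≡-∑ F w) ⟩
      ΔM * ∑[ i < m ] (c * (M - y i))      ≡⟨ cong (ΔM *_) (sym (*-distribˡ-sum c (λ i → M - y i))) ⟩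
      ΔM * (c * ∑[ i < m ] (M - y i))      ≡⟨ cong (λ s → ΔM * (c * s)) ∑[M-y]≡mM-∑y ⟩
      ΔM * (c * (toℚ m * M - sum y))       ≡⟨ solve 3 (λ a c s → a :* (c :* s) := (c :* a) :* s) refl ΔM c _ ⟩
      c * ΔM * (toℚ m * M - sum y)         ≡⟨ cong (_* (toℚ m * M - sum y)) (recip-inverseˡ ΔM (pos⇒≢0 ΔM>0)) ⟩
      1ℚ * (toℚ m * M - sum y)             ≡⟨ *-identityˡ (toℚ m * M - sum y) ⟩
      toℚ m * M - sum y                    ∎
      where
      ΔM = toℚ (Δ F) * M
      ∑[M-y]≡mM-∑y : ∑[ i < m ] (M - y i) ≡ toℚ m * M - sum y
      ∑[M-y]≡mM-∑y = trans (∑-sub (λ _ → M) y) (cong (_- sum y) (∑-const {m} M))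

  ¬improvingDualRay : ∀ {ν} → IsNuStar F ν → toℚ m ≡ toℚ (Δ F) * ν → 0ℚ < toℚ (Δ F) →
                      ∀ y → sum y < 0ℚ → ¬ LoadNonNegAtΔ y
  ¬improvingDualRay {ν} (_ , ν-max) m≡Δν Δ>0 y ∑y<0 load≥0 =
    let w , w-frac , M , M>0 , weight-eq = perturbedMatching Δ>0 y load≥0
        ΔM≥0 = <⇒≤ (*-pos Δ>0 M>0)
        w≤ν = ν-max w w-frac
    in  <-irrefl refl (begin-strict
      toℚ m * M                           ≡⟨ solve 1 (λ s → s := s :+ con 0ℚ) refl (toℚ m * M) ⟩
      toℚ m * M + 0ℚ                      <⟨ +-monoʳ-< (toℚ m * M) (neg-antimono-< ∑y<0) ⟩
      toℚ m * M - sum y                   ≡⟨ sym weight-eq ⟩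
      toℚ (Δ F) * M * weight F w          ≤⟨ *-monoˡ-≤-nonNeg (toℚ (Δ F) * M) {{nonNegative ΔM≥0}} w≤ν ⟩
      toℚ (Δ F) * M * ν                   ≡⟨ solve 3 (λ Δ M ν → Δ :* M :* ν := Δ :* ν :* M) refl (toℚ (Δ F)) M ν ⟩
      toℚ (Δ F) * ν * M                   ≡⟨ cong (_* M) (sym m≡Δν) ⟩
      toℚ m * M                           ∎)
    where open ≤-Reasoning

  strictLabeling-exists : ∀ {ν} → IsNuStar F ν → toℚ m ≡ toℚ (Δ F) * ν → 0ℚ < toℚ (Δ F) →
                          Σ (Fin n → ℚ) (IsStrictLabeling F)
  strictLabeling-exists ν* m≡Δν Δ>0 with fourier-motzkin strictLabelingLP
  ... | inj₁ sol = solution⇒strictLabeling sol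
  ... | inj₂ ref = let y , ∑y<0 , load≥0 = refutation⇒dualRay ref
                   in  ⊥-elim (¬improvingDualRay ν* m≡Δν Δ>0 y ∑y<0 load≥0)

  -- Stabilisation

  strictLabeling⇒labeling : ∀ {lab} → 0ℚ < toℚ (Δ F) → IsStrictLabeling F lab → IsLabeling F lab
  strictLabeling⇒labeling {lab} Δ>0 isStrict =
    (λ u → nonNeg u , lab≤1 u (lab u ≟ 0ℚ)) , (λ i → inj₂ (sums≡1 i)) , vanishes
    where
    open IsStrictLabeling isStrict
    lab≤1 : ∀ u → Dec (lab u ≡ 0ℚ) → lab u ≤ 1ℚ
    lab≤1 u (yes lab≡0) = subst (_≤ 1ℚ) (sym lab≡0) (<⇒≤ 0<1)
    lab≤1 u (no  lab≢0) = let i , χ≢0 = ∑≢0⇒∃≢0 (λ i → χ F i u) ∑χ≢0 in begin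
      lab u                              ≡⟨ sym (*-identityˡ (lab u)) ⟩
      1ℚ * lab u                         ≡⟨ cong (_* lab u) (sym (𝟙≢0⇒≡1 (does (u ∈? edge F i)) χ≢0)) ⟩
      χ F i u * lab u                    ≤⟨ term≤∑ (λ t → *-nonNeg (χ-nonNeg F i t) (nonNeg t)) u ⟩
      ∑[ t < n ] (χ F i t * lab t)       ≡⟨ strict⇒∑≡1 sums≡1 i ⟩
      1ℚ                                 ∎
      where
      open ≤-Reasoning
      ∑χ≢0 : ∑[ i < m ] χ F i u ≢ 0ℚ
      ∑χ≢0 = subst (_≢ 0ℚ) (deg-≡-∑ F u)
        (pos⇒≢0 (subst (λ k → 0ℚ < toℚ k) (sym (nonzero⇒maxDegree {lab} vanishes u lab≢0)) Δ>0))

  record IsDirection (lab : Fin n → ℚ) (v : Fin n) (d : Fin n → ℚ) : Set where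
    field
      supported : ∀ u → lab u ≡ 0ℚ → d u ≡ 0ℚ
      balanced  : ∀ i → χ F i · d ≡ 0ℚ
      unit      : d v ≡ 1ℚ

  zeroFlag : (Fin n → ℚ) → Fin n → ℚ
  zeroFlag lab u = 𝟙 (does (lab u ≟ 0ℚ))

  -- The row for u reads d_u = 0 when lab u = 0 and 0 = 0 otherwise.
  zeroRows : (Fin n → ℚ) → List (Row n)
  zeroRows lab = tabulate (λ u → (λ t → zeroFlag lab u * δ u t) ∣ 0ℚ)

  balanceRows : List (Row n)
  balanceRows = tabulate (λ i → χ F i ∣ 0ℚ)

  directionSystem : (Fin n → ℚ) → Fin n → List (Row n)
  directionSystem lab v = asInequalities (zeroRows lab ++ balanceRows ++ (δ v ∣ 1ℚ) ∷ [])

  zeroRow-value : ∀ lab u (d : Fin n → ℚ) → (λ t → zeroFlag lab u * δ u t) · d ≡ zeroFlag lab u * d u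
  zeroRow-value lab u d = trans (·-scaleˡ (zeroFlag lab u) (δ u) d) (cong (zeroFlag lab u *_) (∑-δ u d))

  solution⇒direction : ∀ {lab v d} → All (d ⊨_) (directionSystem lab v) → IsDirection lab v d
  solution⇒direction {lab} {v} {d} d⊨ = record
    { supported = supported ; balanced = All.tabulate⁻ (++⁻ˡ balanceRows rest) ; unit = unit }
    where
    equations = ⊨-asInequalities⁻ (zeroRows lab ++ balanceRows ++ (δ v ∣ 1ℚ) ∷ []) d⊨
    rest = ++⁻ʳ (zeroRows lab) equations
    supported : ∀ u → lab u ≡ 0ℚ → d u ≡ 0ℚ
    supported u lab≡0 = trans (sym (*-identityˡ (d u)))
      (trans (cong (λ b → 𝟙 b * d u) (sym (dec-true (lab u ≟ 0ℚ) lab≡0)))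
             (trans (sym (zeroRow-value lab u d)) (All.tabulate⁻ (++⁻ˡ (zeroRows lab) equations) u)))
    unit : d v ≡ 1ℚ
    unit = trans (sym (∑-δ v d)) (All.head (++⁻ʳ balanceRows rest))

  direction⇒solution : ∀ {lab v d} → IsDirection lab v d → All (d ⊨_) (directionSystem lab v)
  direction⇒solution {lab} {v} {d} dir = ⊨-asInequalities⁺ (zeroRows lab ++ balanceRows ++ (δ v ∣ 1ℚ) ∷ [])
    (++⁺ (All.tabulate⁺ (λ u → trans (zeroRow-value lab u d) (zeroRow u (lab u ≟ 0ℚ))))
    (++⁺ (All.tabulate⁺ balanced) (trans (∑-δ v d) unit ∷ [])))
    where
    open IsDirection dir
    zeroRow : ∀ u (z? : Dec (lab u ≡ 0ℚ)) → 𝟙 (does z?) * d u ≡ 0ℚ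
    zeroRow u (yes lab≡0) = trans (*-identityˡ (d u)) (supported u lab≡0)
    zeroRow u (no  _)     = *-zeroˡ (d u)

  shrink-support : ∀ {lab v d} → IsStrictLabeling F lab → IsDirection lab v d →
                   Σ (Fin n → ℚ) λ lab′ → IsStrictLabeling F lab′ × support lab′ ⊂ support lab
  shrink-support {lab} {v} {d} isStrict dir = descend (ratio-test lab d v nonNeg (subst (0ℚ <_) (sym unit) 0<1))
    where
    open IsStrictLabeling isStrict
    open IsDirection dir
    descend : (Σ ℚ λ t → (∀ u → t * d u ≤ lab u) × ∃ λ w → 0ℚ < d w × t * d w ≡ lab w) →
              Σ (Fin n → ℚ) λ lab′ → IsStrictLabeling F lab′ × support lab′ ⊂ support lab
    descend (t , t*d≤lab , w , dʷ>0 , t*dʷ≡labʷ) =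
      lab′ , isStrict′ , lab′⊆lab , w , ∈-support⁺ {x = lab} labʷ≢0 , w∉supp-lab′
      where
      lab′ : Fin n → ℚ
      lab′ u = lab u - t * d u
      zeros-kept : ∀ u → lab u ≡ 0ℚ → lab′ u ≡ 0ℚ
      zeros-kept u lab≡0 =
        trans (cong₂ (λ a b → a - t * b) lab≡0 (supported u lab≡0)) (cong (_-_ 0ℚ) (*-zeroʳ t))
      isStrict′ : IsStrictLabeling F lab′
      isStrict′ = record
        { nonNeg   = λ u → p≤q⇒0≤q-p (t*d≤lab u)
        ; vanishes = λ u deg<Δ → zeros-kept u (vanishes u deg<Δ)
        ; sums≡1   = λ i → begin
            edgeSum lab′ (edge F i)          ≡⟨ edgeSum-≡-∑ F lab′ i ⟩
            χ F i · lab′                     ≡⟨ ·-sub-scaledʳ (χ F i) lab d t ⟩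
            χ F i · lab - t * (χ F i · d)    ≡⟨ cong₂ (λ a b → a - t * b) (strict⇒∑≡1 sums≡1 i) (balanced i) ⟩
            1ℚ - t * 0ℚ                      ≡⟨ cong (_-_ 1ℚ) (*-zeroʳ t) ⟩
            1ℚ - 0ℚ                          ≡⟨ +-identityʳ 1ℚ ⟩
            1ℚ                               ∎
        }
        where open ≡-Reasoning
      lab′⊆lab : support lab′ ⊆ₛ support lab
      lab′⊆lab {u} u∈ = ∈-support⁺ {x = lab} (∈-support⁻ {x = lab′} u∈ ∘ zeros-kept u)
      labʷ≢0 : lab w ≢ 0ℚ
      labʷ≢0 lab≡0 = <-irrefl (sym (supported w lab≡0)) dʷ>0
      w∉supp-lab′ : w ∉ₛ support lab′
      w∉supp-lab′ w∈ = ∈-support⁻ {x = lab′} w∈ (trans (cong (_-_ (lab w)) t*dʷ≡labʷ) (+-inverseʳ (lab w)))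

  ¬direction⇒stable : ∀ {lab} → (∀ v d → ¬ IsDirection lab v d) → IsStable F lab
  ¬direction⇒stable {lab} no-direction (lab′ , _ , lab′≢lab , same-sums , same-zeros , _) =
    no-direction v d (record { supported = supported ; balanced = balanced ; unit = recip-inverseˡ _ gap≢0 })
    where
    found = ¬∀⟶∃¬ n (λ v → lab′ v ≡ lab v) (λ v → lab′ v ≟ lab v) lab′≢lab
    v = proj₁ found
    gap≢0 : lab′ v - lab v ≢ 0ℚ
    gap≢0 = proj₂ found ∘ p-q≡0⇒p≡q
    c = recip (lab′ v - lab v) gap≢0
    d : Fin n → ℚ
    d u = c * (lab′ u - lab u)
    supported : ∀ u → lab u ≡ 0ℚ → d u ≡ 0ℚ
    supported u lab≡0 = begin
      c * (lab′ u - lab u)   ≡⟨ cong (λ z → c * (z - lab u)) (Equivalence.to (same-zeros u) lab≡0) ⟩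
      c * (0ℚ - lab u)       ≡⟨ cong (λ z → c * (0ℚ - z)) lab≡0 ⟩
      c * 0ℚ                 ≡⟨ *-zeroʳ c ⟩
      0ℚ                     ∎
      where open ≡-Reasoning
    balanced : ∀ i → χ F i · d ≡ 0ℚ
    balanced i = begin
      χ F i · d                                          ≡⟨ ·-scaled-subʳ (χ F i) lab′ lab c ⟩
      c * (χ F i · lab′ - χ F i · lab)                   ≡⟨ cong (c *_) (sym (cong₂ _-_ (edgeSum-≡-∑ F lab′ i) (edgeSum-≡-∑ F lab i))) ⟩
      c * (edgeSum lab′ (edge F i) - edgeSum lab (edge F i)) ≡⟨ cong (λ z → c * (z - edgeSum lab (edge F i))) (same-sums i) ⟩
      c * (edgeSum lab (edge F i) - edgeSum lab (edge F i))  ≡⟨ cong (c *_) (+-inverseʳ (edgeSum lab (edge F i))) ⟩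
      c * 0ℚ                                             ≡⟨ *-zeroʳ c ⟩
      0ℚ                                                 ∎
      where open ≡-Reasoning

  stabilise : ∀ {lab} → Acc _⊂_ (support lab) → IsStrictLabeling F lab →
              Σ (Fin n → ℚ) λ lab → IsStrictLabeling F lab × IsStable F lab
  stabilise {lab} (acc smaller) isStrict = by-cases (any? (λ v → solvable? (directionSystem lab v)))
    where
    by-cases : Dec (∃ λ v → Solution (directionSystem lab v)) →
               Σ (Fin n → ℚ) λ lab → IsStrictLabeling F lab × IsStable F lab
    by-cases (yes (v , d , d⊨)) =
      let lab′ , isStrict′ , lab′⊂lab = shrink-support isStrict (solution⇒direction {v = v} d⊨)
      in  stabilise (smaller lab′⊂lab) isStrict′
    by-cases (no ∄direction) =
      lab , isStrict , ¬direction⇒stable (λ v d dir → ∄direction (v , d , direction⇒solution dir))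

  zeroLabeling-stable : IsStable F (λ _ → 0ℚ)
  zeroLabeling-stable (lab′ , _ , lab′≢0 , _ , same-zeros , _) = lab′≢0 (λ v → Equivalence.to (same-zeros v) refl)

  noEdges⇒strictStableLabeling : m ≡ 0 → HasStrictStableLabeling F
  noEdges⇒strictStableLabeling m≡0 =
    (λ _ → 0ℚ) , ((λ _ → ≤-refl , <⇒≤ 0<1) , ⊥-elim ∘ noEdge , λ _ _ → refl) , ⊥-elim ∘ noEdge , zeroLabeling-stable
    where
    noEdge : Edge F → ⊥
    noEdge i with () ← subst Fin m≡0 i

  numEdges≡Δν*⇒strictStableLabeling : NumEdges≡Δν* F → HasStrictStableLabeling F
  numEdges≡Δν*⇒strictStableLabeling (ν , ν* , m≡Δν) = [ Δ≡0-case , Δ>0-case ]′ (toℚ-zero-or-pos (Δ F))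
    where
    Δ≡0-case : Δ F ≡ 0 → HasStrictStableLabeling F
    Δ≡0-case Δ≡0 =
      noEdges⇒strictStableLabeling (toℚ≡0⇒≡0 (trans m≡Δν (trans (cong (λ k → toℚ k * ν) Δ≡0) (*-zeroˡ ν))))
    Δ>0-case : 0ℚ < toℚ (Δ F) → HasStrictStableLabeling F
    Δ>0-case Δ>0 =
      let lab , isStrict = strictLabeling-exists ν* m≡Δν Δ>0
          lab′ , isStrict′ , stable = stabilise (⊂-wellFounded (support lab)) isStrict
      in  lab′ , strictLabeling⇒labeling Δ>0 isStrict′ , IsStrictLabeling.sums≡1 isStrict′ , stable

lemma3p8 : ∀ {r n : ℕ} (F : RGraph r n) →
    HasStrictStableLabeling F ⇔
      (Σ ℚ λ ν → IsNuStar F ν × (toℚ (numEdges F) ≡ toℚ (Δ F) * ν))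
lemma3p8 F = mk⇔
  (λ (_ , isLabeling , strict , _) → strictLabeling⇒numEdges≡Δν* F (labeling⇒strictLabeling F isLabeling strict))
  (numEdges≡Δν*⇒strictStableLabeling F)
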